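{- \[F(x,y,1)=F^N(x,1)+(1+y)M^U(x,y,1)=F^N(x,1)+\left(1+\frac{1}{y}\right)M^D(x,y,1).\]
   Context: Sorting procedure: a permutation $\pi$ is processed using an input sequence (initially $\pi_1,\ldots,\pi_n$), a stack and an output. Let $m$ be the smallest value not yet output. At each step: if the stack's top entry equals $m$, pop it to the output; otherwise, if the input is nonempty, push the next input entry onto the stack. When no move is possible and the stack is nonempty, the remaining stack entries are returned to the input in the reverse of their order in the previous input (i.e. listed from top of stack to bottom), and the procedure is repeated. The rev-tier $t_{rev}(\alpha)$ is the number of times entries must be returned to the input before the output is $1,2,\ldots,n$. For $\sigma\in S_n$, $(i,i+1)$ is a separated pair if some entry $k>i+1$ lies between $i$ and $i+1$ in $\sigma$; it is up separated if $i$ precedes $i+1$, down separated otherwise. An ISASP is a sequence of separated pairs $(i_1,i_1+1),\ldots,(i_p,i_p+1)$ with $i_1<\cdots<i_p$ and alternating orientations. $\sigma$ is up-oriented (resp. down-oriented) if it has a separated pair and every maximum length ISASP begins with an up (resp. down) separated pair; $N$ is the set of permutations with no separated pairs. For a permutation $\alpha$ of length $n(\alpha)$ with $1$ in position $k(\alpha)$, let $\Theta(\alpha)=x^{n(\alpha)}y^{t_{rev}(\alpha)}w^{k(\alpha)-1}$. Define $F(x,y,w)=\sum_{\alpha}\Theta(\alpha)$ over all permutations of length $\ge1$, $F^N(x,w)=\sum_{\alpha\in N}\Theta(\alpha)$ (rev-tier of elements of $N$ is $0$), $M^U(x,y,w)=\sum_{\alpha\text{ up-oriented}}\Theta(\alpha)$,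 $M^D(x,y,w)=\sum_{\alpha\text{ down-oriented}}\Theta(\alpha)$. -}

module Defs where

open import Data.Nat using (ℕ; zero; suc; _+_; _∸_; _≡ᵇ_; _<ᵇ_; _⊔_)
open import Data.Bool using (Bool; true; false; if_then_else_; _∧_; _∨_; not)
open import Data.List using (List; []; _∷_; length; filter; map; concatMap; take; drop; upTo; foldr; null)
open import Data.Bool.ListAction using (any; all)
open import Data.Maybe using (Maybe; just; nothing)
open import Data.Product using (_×_; _,_)
open import Relation.Nullary.Decidable using (yes; no)
open import Data.Bool using (T; T?)

-- Permutations of length n, as lists of the values 1..n (one-line notation).

insertAll : ℕ → List ℕ → List (List ℕ)
insertAll x []       = (x ∷ []) ∷ []
insertAll x (y ∷ ys) = (x ∷ y ∷ ys) ∷ map (y ∷_) (insertAll x ys)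

perms : ℕ → List (List ℕ)
perms zero    = [] ∷ []
perms (suc n) = concatMap (insertAll (suc n)) (perms n)

count : {A : Set} → (A → Bool) → List A → ℕ
count p xs = length (filter (λ a → T? (p a)) xs)

-- pop entries from the stack while the top equals m (the smallest value
-- not yet output); returns the new m and the new stack (top first).
popAll : ℕ → List ℕ → ℕ × List ℕ
popAll m []       = m , []
popAll m (s ∷ ss) = if s ≡ᵇ m then popAll (suc m) ss else (m , s ∷ ss)

pass : ℕ → List ℕ → List ℕ → ℕ × List ℕ
pass m []       st = popAll m st
pass m (x ∷ xs) st with popAll m st
... | m' , st' = pass m' xs (x ∷ st')

-- Run passes with fuel; when a pass stops with nonempty stack, the stack
-- (listed from top to bottom) becomes the new input, counting one return.
runTier : ℕ → ℕ → List ℕ → Maybe ℕ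
runTier fuel m inp with pass m inp []
... | m' , []      = just 0
runTier zero m inp     | m' , (s ∷ st) = nothing
runTier (suc f) m inp  | m' , (s ∷ st) with runTier f m' (s ∷ st)
... | just t  = just (suc t)
... | nothing = nothing

-- rev-tier of a permutation (each pass outputs at least one entry, so
-- fuel = length suffices; `nothing` never occurs for permutations).
revTier : List ℕ → Maybe ℕ
revTier σ = runTier (length σ) 1 σ

hasTier : ℕ → List ℕ → Bool
hasTier t σ with revTier σ
... | just t' = t' ≡ᵇ t
... | nothing = false

-- 0-based position of value v in σ (length σ if absent).
pos : ℕ → List ℕ → ℕ
pos v []       = 0
pos v (x ∷ xs) = if x ≡ᵇ v then 0 else suc (pos v xs)

min' : ℕ → ℕ → ℕ
min' a b = if a <ᵇ b then a else b

between : ℕ → ℕ → List ℕ → List ℕ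
between p q σ = drop (suc (min' p q)) (take (p ⊔ q) σ)

separated : List ℕ → ℕ → Bool
separated σ i = any (λ k → suc i <ᵇ k) (between (pos i σ) (pos (suc i) σ) σ)

-- orientation: true = up (i precedes i+1), false = down
isUp : List ℕ → ℕ → Bool
isUp σ i = pos i σ <ᵇ pos (suc i) σ

sepPairs : List ℕ → List (ℕ × Bool)
sepPairs σ = map (λ i → i , isUp σ i)
                 (filter (λ i → T? (separated σ i)) (map suc (upTo (length σ ∸ 1))))

sublists : {A : Set} → List A → List (List A)
sublists []       = [] ∷ []
sublists (x ∷ xs) = let r = sublists xs in map (x ∷_) r Data.List.++ r

alternating : List (ℕ × Bool) → Bool
alternating []                              = true
alternating (_ ∷ [])                        = true
alternating ((_ , o) ∷ (j , o') ∷ rest) = not (o ≡ᵇᵇ o') ∧ alternating ((j , o') ∷ rest)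
  where
  _≡ᵇᵇ_ : Bool → Bool → Bool
  true  ≡ᵇᵇ b = b
  false ≡ᵇᵇ b = not b

isasps : List ℕ → List (List (ℕ × Bool))
isasps σ = filter (λ s → T? (not (null s) ∧ alternating s)) (sublists (sepPairs σ))

maxLen : List (List (ℕ × Bool)) → ℕ
maxLen = foldr (λ s m → length s ⊔ m) 0

startsWith : Bool → List (ℕ × Bool) → Bool
startsWith b []             = false
startsWith b ((_ , o) ∷ _) = if b then o else not o

oriented : Bool → List ℕ → Bool
oriented b σ = not (null (sepPairs σ)) ∧
  all (λ s → not (length s ≡ᵇ maxLen (isasps σ)) ∨ startsWith b s) (isasps σ)

inN : List ℕ → Bool
inN σ = null (sepPairs σ)

-- Coefficients of x^n y^t in F(x,y,1), F^N(x,1), M^U(x,y,1), M^D(x,y,1).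

coeffF : ℕ → ℕ → ℕ
coeffF n t = count (hasTier t) (perms n)

-- F^N(x,1) has no y: its coefficient of y^t is #N_n if t = 0, else 0.
coeffFN : ℕ → ℕ → ℕ
coeffFN n zero    = count inN (perms n)
coeffFN n (suc t) = 0

coeffMU : ℕ → ℕ → ℕ
coeffMU n t = count (λ σ → oriented true σ ∧ hasTier t σ) (perms n)

coeffMD : ℕ → ℕ → ℕ
coeffMD n t = count (λ σ → oriented false σ ∧ hasTier t σ) (perms n)

-- coefficient of y^t in y·M^U(x,y,1)
coeffYMU : ℕ → ℕ → ℕ
coeffYMU n zero    = 0
coeffYMU n (suc t) = coeffMU n t

module Submission where

-- Write sp σ for the increasing list of separated pairs of σ with their
-- orientations, and greedyAlt c L for the length of the greedy alternating
-- subsequence of L whose first pair has orientation c (true = up).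
--  (1) One pass of the procedure, on an input holding exactly the values
--      m..M, outputs m..c where c is the least down separated pair ≥ m (or M),
--      and returns the entries > c in reversed order.  Iterating passes, the
--      rev-tier of σ is greedyAlt down (sp σ)                  (revTier-formula)
--  (2) Every maximum ISASP begins with the orientation of the first separated
--      pair, so σ is up/down-oriented iff sp σ starts with an up/down pair
--                                                               (oriented-head)
--  (3) Reversal permutes S_n and flips every orientation in sp σ, hence
--      rev-tier (reverse σ) = greedyAlt up (sp σ)              (sepPairs-reverse)
-- Splitting S_n into N, up- and down-oriented permutations gives
-- F = F^N + M^U + M^D; by (1)-(2) no down-oriented σ has tier 0, and by (3)
-- reversal matches down-oriented permutations of tier t+1 with up-oriented
-- ones of tier t, i.e. M^D = y M^U; both identities follow.

open import Defs
open import Data.Nat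
  using (ℕ; zero; suc; _+_; _∸_; _≤_; _<_; z≤n; s≤s; _≡ᵇ_; _<ᵇ_; _≤?_; _≟_)
open import Data.Nat.Properties
open import Data.Nat.Tactic.RingSolver using (solve-∀)
open import Data.Bool using (Bool; true; false; if_then_else_; _∧_; _∨_; _xor_; not; T?)
open import Data.Bool.Properties using (∨-comm; ∨-assoc; ∨-zeroʳ; ∧-zeroʳ; ∧-identityʳ; T-≡)
open import Data.Bool.ListAction using (any; all)
open import Data.List
  using (List; []; _∷_; _++_; [_]; length; filter; map; concatMap; take; upTo;
         applyUpTo; null; reverse; _ʳ++_)
open import Data.List.Properties
  using (++-assoc; reverse-++; unfold-reverse; ++-identityʳ; ʳ++-defn; reverse-involutive;
         length-++; length-reverse; map-applyUpTo; map-++; map-∘; reverse-map; map-cong;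
         map-concatMap; concatMap-map)
open import Data.List.Membership.Propositional using (_∈_; _∉_; find)
open import Data.List.Membership.Propositional.Properties
  using (∈-∃++; ∈-filter⁺; ∈-filter⁻; ∈-map⁺; ∈-map⁻; ∈-concatMap⁻)
open import Data.List.Relation.Unary.Any using (here; there)
import Data.List.Relation.Unary.Any.Properties as Any
open import Data.List.Relation.Binary.Permutation.Propositional
  using (_↭_; ↭-sym; ↭-reflexive; prep; swap) renaming (refl to ↭-refl; trans to ↭-trans)
open import Data.List.Relation.Binary.Permutation.Propositional.Properties
  using (∈-resp-↭; ↭-length; ++⁺; ++⁺ˡ; shifts; ↭-reverse; filter-↭; ++-comm)
open import Data.Product using (_×_; _,_; proj₁; proj₂; Σ)
open import Data.Sum using (_⊎_; inj₁; inj₂)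
open import Data.Empty using (⊥; ⊥-elim)
open import Data.Unit using (⊤; tt)
open import Data.Maybe using (just)
open import Function.Bundles using (Equivalence)
open import Relation.Nullary using (¬_; yes; no)
open import Relation.Binary.PropositionalEquality hiding ([_])

≡ᵇ-refl : ∀ x → (x ≡ᵇ x) ≡ true
≡ᵇ-refl zero    = refl
≡ᵇ-refl (suc x) = ≡ᵇ-refl x

≡ᵇ-true⁻ : ∀ x y → (x ≡ᵇ y) ≡ true → x ≡ y
≡ᵇ-true⁻ x y e = ≡ᵇ⇒≡ x y (Equivalence.from T-≡ e)

≡ᵇ-false : ∀ x y → x ≢ y → (x ≡ᵇ y) ≡ false
≡ᵇ-false x y x≢y with x ≡ᵇ y in e
... | false = refl
... | true  = ⊥-elim (x≢y (≡ᵇ-true⁻ x y e))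

≡ᵇ-false⁻ : ∀ x y → (x ≡ᵇ y) ≡ false → x ≢ y
≡ᵇ-false⁻ x y e refl with () ← trans (sym e) (≡ᵇ-refl x)

<ᵇ-true : ∀ {m n} → m < n → (m <ᵇ n) ≡ true
<ᵇ-true m<n = Equivalence.to T-≡ (<⇒<ᵇ m<n)

<ᵇ-true⁻ : ∀ {m n} → (m <ᵇ n) ≡ true → m < n
<ᵇ-true⁻ {m} {n} e = <ᵇ⇒< m n (Equivalence.from T-≡ e)

<ᵇ-false : ∀ {m n} → n ≤ m → (m <ᵇ n) ≡ false
<ᵇ-false {m} {n} n≤m with m <ᵇ n in e
... | false = refl
... | true  = ⊥-elim (<⇒≱ (<ᵇ-true⁻ e) n≤m)

<ᵇ-weaken : ∀ {c0 c} → c0 ≤ c → ∀ x → (c <ᵇ x) ≡ true → (c0 <ᵇ x) ≡ true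
<ᵇ-weaken {c0} {c} c0≤c x e = <ᵇ-true {c0} {x} (≤-<-trans c0≤c (<ᵇ-true⁻ {c} {x} e))

n≢1+n : ∀ j → j ≢ suc j
n≢1+n j ()

before : ℕ → List ℕ → List ℕ
before b []       = []
before b (x ∷ xs) = if x ≡ᵇ b then [] else x ∷ before b xs

segment : ℕ → ℕ → List ℕ → List ℕ
segment a b []       = []
segment a b (x ∷ xs) =
  if x ≡ᵇ a then before b xs else (if x ≡ᵇ b then before a xs else segment a b xs)

occursBefore : ℕ → ℕ → List ℕ → Bool
occursBefore a b []       = false
occursBefore a b (x ∷ xs) = if x ≡ᵇ a then true else (if x ≡ᵇ b then false else occursBefore a b xs)

-- Structural versions of "(j, j+1) is separated / up / down separated in W";
-- unlike Defs.separated and Defs.isUp they avoid positions, so they commute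
-- with sublists and reversal.
sepAt : ℕ → List ℕ → Bool
sepAt j W = any (suc j <ᵇ_) (segment j (suc j) W)

upAt : ℕ → List ℕ → Bool
upAt j W = occursBefore j (suc j) W

downAt : ℕ → List ℕ → Bool
downAt j W = sepAt j W ∧ not (upAt j W)

before≡take : ∀ b xs → before b xs ≡ take (pos b xs) xs
before≡take b []       = refl
before≡take b (x ∷ xs) with x ≡ᵇ b
... | true  = refl
... | false = cong (x ∷_) (before≡take b xs)

min'-suc : ∀ p q → min' (suc p) (suc q) ≡ suc (min' p q)
min'-suc p q with p <ᵇ q
... | true  = refl
... | false = refl

between≡segment : ∀ a b σ → a ≢ b → between (pos a σ) (pos b σ) σ ≡ segment a b σ
between≡segment a b [] a≢b = refl
between≡segment a b (x ∷ xs) a≢b with x ≡ᵇ a in ea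
... | true rewrite ≡ᵇ-false x b (λ x≡b → a≢b (trans (sym (≡ᵇ-true⁻ x a ea)) x≡b)) =
  sym (before≡take b xs)
... | false with x ≡ᵇ b
...   | true  = sym (before≡take a xs)
...   | false rewrite min'-suc (pos a xs) (pos b xs) = between≡segment a b xs a≢b

pos<ᵇ≡occursBefore : ∀ a b σ → a ≢ b → (pos a σ <ᵇ pos b σ) ≡ occursBefore a b σ
pos<ᵇ≡occursBefore a b [] a≢b = refl
pos<ᵇ≡occursBefore a b (x ∷ xs) a≢b with x ≡ᵇ a in ea
... | true rewrite ≡ᵇ-false x b (λ x≡b → a≢b (trans (sym (≡ᵇ-true⁻ x a ea)) x≡b)) = refl
... | false with x ≡ᵇ b
...   | true  = refl
...   | false = pos<ᵇ≡occursBefore a b xs a≢b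

separated≡sepAt : ∀ σ j → separated σ j ≡ sepAt j σ
separated≡sepAt σ j = cong (any (suc j <ᵇ_)) (between≡segment j (suc j) σ (n≢1+n j))

isUp≡upAt : ∀ σ j → isUp σ j ≡ upAt j σ
isUp≡upAt σ j = pos<ᵇ≡occursBefore j (suc j) σ (n≢1+n j)

-- Lists without repeated entries.  (The library's Unique lacks the splitting
-- and reversal lemmas needed here; this x ∉ xs formulation makes them direct.)
data Distinct : List ℕ → Set where
  []ᵈ  : Distinct []
  _∷ᵈ_ : ∀ {x xs} → x ∉ xs → Distinct xs → Distinct (x ∷ xs)

∉-++ : ∀ {x : ℕ} (A : List ℕ) {B : List ℕ} → x ∉ A → x ∉ B → x ∉ A ++ B
∉-++ A x∉A x∉B p with Any.++⁻ A p
... | inj₁ q = x∉A q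
... | inj₂ q = x∉B q

∉-++ˡ : ∀ {x : ℕ} (A : List ℕ) {B : List ℕ} → x ∉ A ++ B → x ∉ A
∉-++ˡ A x∉AB p = x∉AB (Any.++⁺ˡ p)

∉-rev : ∀ {x : ℕ} (A : List ℕ) → x ∉ A → x ∉ reverse A
∉-rev A x∉A p = x∉A (Any.reverse⁻ p)

head≢ : ∀ {x y : ℕ} {A : List ℕ} → x ∉ y ∷ A → y ≢ x
head≢ x∉ refl = x∉ (here refl)

tail∉ : ∀ {x y : ℕ} {A : List ℕ} → x ∉ y ∷ A → x ∉ A
tail∉ x∉ p = x∉ (there p)

distinct-++ʳ : ∀ (A : List ℕ) {B} → Distinct (A ++ B) → Distinct B
distinct-++ʳ []      d         = d
distinct-++ʳ (x ∷ A) (_ ∷ᵈ d) = distinct-++ʳ A d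

distinct-disjoint : ∀ A {B x} → Distinct (A ++ B) → x ∈ A → x ∉ B
distinct-disjoint (y ∷ A) (y∉ ∷ᵈ d) (here refl) q = y∉ (Any.++⁺ʳ A q)
distinct-disjoint (y ∷ A) (_ ∷ᵈ d)  (there p)   q = distinct-disjoint A d p q

distinct-mid : ∀ A {x B} → Distinct (A ++ x ∷ B) → x ∉ A × x ∉ B
distinct-mid A {x} d with distinct-++ʳ A d
... | x∉B ∷ᵈ _ = (λ p → distinct-disjoint A d p (here refl)) , x∉B

distinct-++ : ∀ A {B} → Distinct A → Distinct B → (∀ {x} → x ∈ A → x ∉ B) → Distinct (A ++ B)
distinct-++ []      dA          dB disj = dB
distinct-++ (y ∷ A) (y∉ ∷ᵈ dA) dB disj =
  ∉-++ A y∉ (disj (here refl)) ∷ᵈ distinct-++ A dA dB (λ p → disj (there p))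

distinct-reverse : ∀ A → Distinct A → Distinct (reverse A)
distinct-reverse []      d          = []ᵈ
distinct-reverse (x ∷ A) (x∉ ∷ᵈ d) rewrite unfold-reverse x A =
  distinct-++ (reverse A) (distinct-reverse A d) ((λ ()) ∷ᵈ []ᵈ)
    (λ { p (here refl) → x∉ (Any.reverse⁻ p) })

distinct-↭ : ∀ {xs ys} → xs ↭ ys → Distinct xs → Distinct ys
distinct-↭ ↭-refl d = d
distinct-↭ (prep x p) (x∉ ∷ᵈ d) = (λ q → x∉ (∈-resp-↭ (↭-sym p) q)) ∷ᵈ distinct-↭ p d
distinct-↭ (swap x y p) (x∉ ∷ᵈ (y∉ ∷ᵈ d)) =
  (λ { (here refl) → x∉ (here refl) ; (there q) → y∉ (∈-resp-↭ (↭-sym p) q) }) ∷ᵈ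
  ((λ q → x∉ (there (∈-resp-↭ (↭-sym p) q))) ∷ᵈ distinct-↭ p d)
distinct-↭ (↭-trans p q) d = distinct-↭ q (distinct-↭ p d)

record Isolated (A : List ℕ) (x : ℕ) (B : List ℕ) (y : ℕ) (C : List ℕ) : Set where
  field
    x∉A : x ∉ A
    y∉A : y ∉ A
    x∉B : x ∉ B
    y∉B : y ∉ B
    x∉C : x ∉ C
    y∉C : y ∉ C

isolated : ∀ A {x B y C} → Distinct (A ++ x ∷ B ++ y ∷ C) → Isolated A x B y C
isolated A {x} {B} {y} {C} d = record
  { x∉A = x∉A
  ; y∉A = λ p → distinct-disjoint A d p (there (Any.++⁺ʳ B (here refl)))
  ; x∉B = ∉-++ˡ B x∉BC
  ; y∉B = proj₁ yB
  ; x∉C = λ p → x∉BC (Any.++⁺ʳ B (there p))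
  ; y∉C = proj₂ yB }
  where
  x∉A : x ∉ A
  x∉A = proj₁ (distinct-mid A d)
  x∉BC : x ∉ B ++ y ∷ C
  x∉BC = proj₂ (distinct-mid A d)
  yB : y ∉ B × y ∉ C
  yB = distinct-mid B (distinct-++ʳ (x ∷ []) (distinct-++ʳ A d))

Splitting : ℕ → ℕ → List ℕ → Set
Splitting x y W =
  Σ (List ℕ) λ A → Σ (List ℕ) λ B → Σ (List ℕ) λ C → (W ≡ A ++ x ∷ B ++ y ∷ C) × Isolated A x B y C

splitting : ∀ {W a b} → Distinct W → a ∈ W → b ∈ W → a ≢ b → Splitting a b W ⊎ Splitting b a W
splitting {W} {a} {b} d a∈W b∈W a≢b with ∈-∃++ a∈W
... | A₁ , C₁ , refl with Any.++⁻ A₁ b∈W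
...   | inj₂ (here refl) = ⊥-elim (a≢b refl)
...   | inj₂ (there b∈C) with ∈-∃++ b∈C
...     | B , C , refl = inj₁ (A₁ , B , C , refl , isolated A₁ d)
splitting {W} {a} {b} d a∈W b∈W a≢b | A₁ , C₁ , refl | inj₁ b∈A with ∈-∃++ b∈A
...     | A , B , refl rewrite ++-assoc A (b ∷ B) (a ∷ C₁) = inj₂ (A , B , C₁ , refl , isolated A d)

before-split : ∀ b (B : List ℕ) {C : List ℕ} → b ∉ B → before b (B ++ b ∷ C) ≡ B
before-split b []      b∉ rewrite ≡ᵇ-refl b = refl
before-split b (y ∷ B) b∉ rewrite ≡ᵇ-false y b (head≢ b∉) = cong (y ∷_) (before-split b B (tail∉ b∉))

segment-split : ∀ a b A {B C} → a ∉ A → b ∉ A → b ∉ B → segment a b (A ++ a ∷ B ++ b ∷ C) ≡ B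
segment-split a b []      {B} a∉A b∉A b∉B rewrite ≡ᵇ-refl a = before-split b B b∉B
segment-split a b (y ∷ A) a∉A b∉A b∉B rewrite ≡ᵇ-false y a (head≢ a∉A) | ≡ᵇ-false y b (head≢ b∉A) =
  segment-split a b A (tail∉ a∉A) (tail∉ b∉A) b∉B

segment-split' : ∀ a b A {B C} → a ≢ b → a ∉ A → b ∉ A → a ∉ B → segment a b (A ++ b ∷ B ++ a ∷ C) ≡ B
segment-split' a b []      {B} a≢b a∉A b∉A a∉B
  rewrite ≡ᵇ-false b a (λ e → a≢b (sym e)) | ≡ᵇ-refl b = before-split a B a∉B
segment-split' a b (y ∷ A) a≢b a∉A b∉A a∉B rewrite ≡ᵇ-false y a (head≢ a∉A) | ≡ᵇ-false y b (head≢ b∉A) =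
  segment-split' a b A a≢b (tail∉ a∉A) (tail∉ b∉A) a∉B

occursBefore-split : ∀ a b A {R} → a ∉ A → b ∉ A → occursBefore a b (A ++ a ∷ R) ≡ true
occursBefore-split a b []      a∉A b∉A rewrite ≡ᵇ-refl a = refl
occursBefore-split a b (y ∷ A) a∉A b∉A rewrite ≡ᵇ-false y a (head≢ a∉A) | ≡ᵇ-false y b (head≢ b∉A) =
  occursBefore-split a b A (tail∉ a∉A) (tail∉ b∉A)

occursBefore-split' : ∀ a b A {R} → a ≢ b → a ∉ A → b ∉ A → occursBefore a b (A ++ b ∷ R) ≡ false
occursBefore-split' a b []      a≢b a∉A b∉A rewrite ≡ᵇ-false b a (λ e → a≢b (sym e)) | ≡ᵇ-refl b = refl
occursBefore-split' a b (y ∷ A) a≢b a∉A b∉A rewrite ≡ᵇ-false y a (head≢ a∉A) | ≡ᵇ-false y b (head≢ b∉A) =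
  occursBefore-split' a b A a≢b (tail∉ a∉A) (tail∉ b∉A)

reverse-split : ∀ (A : List ℕ) x B y C → reverse (A ++ x ∷ B ++ y ∷ C) ≡ reverse C ++ y ∷ reverse B ++ x ∷ reverse A
reverse-split A x B y C = begin
  reverse (A ++ x ∷ B ++ y ∷ C)                                ≡⟨ reverse-++ A (x ∷ B ++ y ∷ C) ⟩
  reverse (x ∷ B ++ y ∷ C) ++ reverse A                        ≡⟨ cong (_++ reverse A) (unfold-reverse x (B ++ y ∷ C)) ⟩
  (reverse (B ++ y ∷ C) ++ [ x ]) ++ reverse A                 ≡⟨ cong (λ z → (z ++ [ x ]) ++ reverse A) (reverse-++ B (y ∷ C)) ⟩
  ((reverse (y ∷ C) ++ reverse B) ++ [ x ]) ++ reverse A       ≡⟨ cong (λ z → ((z ++ reverse B) ++ [ x ]) ++ reverse A) (unfold-reverse y C) ⟩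
  (((reverse C ++ [ y ]) ++ reverse B) ++ [ x ]) ++ reverse A  ≡⟨ ++-assoc ((reverse C ++ [ y ]) ++ reverse B) [ x ] (reverse A) ⟩
  ((reverse C ++ [ y ]) ++ reverse B) ++ x ∷ reverse A         ≡⟨ ++-assoc (reverse C ++ [ y ]) (reverse B) (x ∷ reverse A) ⟩
  (reverse C ++ [ y ]) ++ reverse B ++ x ∷ reverse A           ≡⟨ ++-assoc (reverse C) [ y ] (reverse B ++ x ∷ reverse A) ⟩
  reverse C ++ y ∷ reverse B ++ x ∷ reverse A                  ∎
  where open ≡-Reasoning

segment-reverse : ∀ {W a b} → Distinct W → a ∈ W → b ∈ W → a ≢ b →
                  (segment a b (reverse W) ≡ reverse (segment a b W))
                  × (occursBefore a b (reverse W) ≡ not (occursBefore a b W))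
segment-reverse {W} {a} {b} d a∈W b∈W a≢b with splitting d a∈W b∈W a≢b
... | inj₁ (A , B , C , refl , iso) = let open Isolated iso in
  trans (cong (segment a b) (reverse-split A a B b C))
    (trans (segment-split' a b (reverse C) a≢b (∉-rev C x∉C) (∉-rev C y∉C) (∉-rev B x∉B))
           (cong reverse (sym (segment-split a b A x∉A y∉A y∉B)))) ,
  trans (cong (occursBefore a b) (reverse-split A a B b C))
    (trans (occursBefore-split' a b (reverse C) a≢b (∉-rev C x∉C) (∉-rev C y∉C))
           (cong not (sym (occursBefore-split a b A x∉A y∉A))))
... | inj₂ (A , B , C , refl , iso) = let open Isolated iso in
  trans (cong (segment a b) (reverse-split A b B a C))
    (trans (segment-split a b (reverse C) (∉-rev C y∉C) (∉-rev C x∉C) (∉-rev B x∉B))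
           (cong reverse (sym (segment-split' a b A a≢b y∉A x∉A y∉B)))) ,
  trans (cong (occursBefore a b) (reverse-split A b B a C))
    (trans (occursBefore-split a b (reverse C) (∉-rev C y∉C) (∉-rev C x∉C))
           (cong not (sym (occursBefore-split' a b A a≢b y∉A x∉A))))

any-++ : ∀ (q : ℕ → Bool) xs ys → any q (xs ++ ys) ≡ any q xs ∨ any q ys
any-++ q []       ys = refl
any-++ q (x ∷ xs) ys rewrite any-++ q xs ys = sym (∨-assoc (q x) (any q xs) (any q ys))

any-reverse : ∀ (q : ℕ → Bool) xs → any q (reverse xs) ≡ any q xs
any-reverse q []       = refl
any-reverse q (x ∷ xs) rewrite unfold-reverse x xs | any-++ q (reverse xs) [ x ] | any-reverse q xs =
  trans (cong (any q xs ∨_) (∨-comm (q x) false)) (∨-comm (any q xs) (q x))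

any-∈ : ∀ (q : ℕ → Bool) {x} L → x ∈ L → q x ≡ true → any q L ≡ true
any-∈ q (y ∷ L) (here refl) e rewrite e = refl
any-∈ q (y ∷ L) (there p)   e rewrite any-∈ q L p e = ∨-zeroʳ (q y)

sepAt-reverse : ∀ j L → Distinct L → j ∈ L → suc j ∈ L → sepAt j (reverse L) ≡ sepAt j L
sepAt-reverse j L d a b =
  trans (cong (any (suc j <ᵇ_)) (proj₁ (segment-reverse d a b (n≢1+n j))))
        (any-reverse (suc j <ᵇ_) (segment j (suc j) L))

upAt-reverse : ∀ j L → Distinct L → j ∈ L → suc j ∈ L → upAt j (reverse L) ≡ not (upAt j L)
upAt-reverse j L d a b = proj₂ (segment-reverse d a b (n≢1+n j))

-- Boolean filter; it computes by pattern matching on p x, which the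
-- rewriting below relies on.
keep : (ℕ → Bool) → List ℕ → List ℕ
keep p []       = []
keep p (x ∷ xs) = if p x then x ∷ keep p xs else keep p xs

keep-∈⁻ : ∀ p {x} A → x ∈ keep p A → x ∈ A × p x ≡ true
keep-∈⁻ p (y ∷ A) q with p y in e
keep-∈⁻ p (y ∷ A) (here refl) | true = here refl , e
keep-∈⁻ p (y ∷ A) (there q)   | true = let (a , b) = keep-∈⁻ p A q in there a , b
... | false = let (a , b) = keep-∈⁻ p A q in there a , b

keep-∈⁺ : ∀ p {x} A → x ∈ A → p x ≡ true → x ∈ keep p A
keep-∈⁺ p (y ∷ A) (here refl) e rewrite e = here refl
keep-∈⁺ p (y ∷ A) (there q)   e with p y
... | true  = there (keep-∈⁺ p A q e)
... | false = keep-∈⁺ p A q e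

distinct-keep : ∀ p A → Distinct A → Distinct (keep p A)
distinct-keep p []      d          = []ᵈ
distinct-keep p (y ∷ A) (y∉ ∷ᵈ d) with p y
... | true  = (λ q → y∉ (proj₁ (keep-∈⁻ p A q))) ∷ᵈ distinct-keep p A d
... | false = distinct-keep p A d

keep-++ : ∀ p A B → keep p (A ++ B) ≡ keep p A ++ keep p B
keep-++ p []      B = refl
keep-++ p (y ∷ A) B with p y
... | true  = cong (y ∷_) (keep-++ p A B)
... | false = keep-++ p A B

keep-all : ∀ p A → (∀ {x} → x ∈ A → p x ≡ true) → keep p A ≡ A
keep-all p []      h = refl
keep-all p (y ∷ A) h rewrite h (here refl) = cong (y ∷_) (keep-all p A (λ q → h (there q)))

keep-none : ∀ p A → (∀ {x} → x ∈ A → p x ≡ false) → keep p A ≡ []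
keep-none p []      h = refl
keep-none p (y ∷ A) h rewrite h (here refl) = keep-none p A (λ q → h (there q))

keep-reverse : ∀ p A → keep p (reverse A) ≡ reverse (keep p A)
keep-reverse p [] = refl
keep-reverse p (y ∷ A) rewrite unfold-reverse y A | keep-++ p (reverse A) [ y ] | keep-reverse p A with p y
... | true  = sym (unfold-reverse y (keep p A))
... | false = ++-identityʳ _

keep-keep : ∀ p q A → (∀ x → p x ≡ true → q x ≡ true) → keep p (keep q A) ≡ keep p A
keep-keep p q []      h = refl
keep-keep p q (y ∷ A) h with q y in eq | p y in ep
... | true  | true  rewrite ep = cong (y ∷_) (keep-keep p q A h)
... | true  | false rewrite ep = keep-keep p q A h
... | false | false = keep-keep p q A h
... | false | true with () ← trans (sym eq) (h y ep)

before-keep : ∀ p b A → p b ≡ true → before b (keep p A) ≡ keep p (before b A)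
before-keep p b []      pb = refl
before-keep p b (y ∷ A) pb with p y in ey | y ≡ᵇ b in eb
... | true  | true  rewrite eb = refl
... | true  | false rewrite eb | ey = cong (y ∷_) (before-keep p b A pb)
... | false | false rewrite ey = before-keep p b A pb
... | false | true with () ← trans (sym ey) (trans (cong p (≡ᵇ-true⁻ y b eb)) pb)

segment-keep : ∀ p a b A → p a ≡ true → p b ≡ true → segment a b (keep p A) ≡ keep p (segment a b A)
segment-keep p a b []      pa pb = refl
segment-keep p a b (y ∷ A) pa pb with p y in ey | y ≡ᵇ a in ea | y ≡ᵇ b in eb
... | true  | true  | _    rewrite ea = before-keep p b A pb
... | true  | false | true rewrite ea | eb = before-keep p a A pa
... | true  | false | false rewrite ea | eb = segment-keep p a b A pa pb
... | false | false | false = segment-keep p a b A pa pb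
... | false | true  | _    with () ← trans (sym ey) (trans (cong p (≡ᵇ-true⁻ y a ea)) pa)
... | false | false | true with () ← trans (sym ey) (trans (cong p (≡ᵇ-true⁻ y b eb)) pb)

occursBefore-keep : ∀ p a b A → p a ≡ true → p b ≡ true → occursBefore a b (keep p A) ≡ occursBefore a b A
occursBefore-keep p a b []      pa pb = refl
occursBefore-keep p a b (y ∷ A) pa pb with p y in ey | y ≡ᵇ a in ea | y ≡ᵇ b in eb
... | true  | true  | _    rewrite ea = refl
... | true  | false | true rewrite ea | eb = refl
... | true  | false | false rewrite ea | eb = occursBefore-keep p a b A pa pb
... | false | false | false = occursBefore-keep p a b A pa pb
... | false | true  | _    with () ← trans (sym ey) (trans (cong p (≡ᵇ-true⁻ y a ea)) pa)
... | false | false | true with () ← trans (sym ey) (trans (cong p (≡ᵇ-true⁻ y b eb)) pb)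

any-keep : ∀ (q p : ℕ → Bool) A → (∀ x → q x ≡ true → p x ≡ true) → any q (keep p A) ≡ any q A
any-keep q p []      h = refl
any-keep q p (y ∷ A) h with p y in ep
... | true = cong (q y ∨_) (any-keep q p A h)
... | false with q y in eq
...   | false = any-keep q p A h
...   | true with () ← trans (sym ep) (h y eq)

sepAt-keep : ∀ c0 j L → c0 < j → sepAt j (keep (c0 <ᵇ_) L) ≡ sepAt j L
sepAt-keep c0 j L c0<j =
  trans (cong (any (suc j <ᵇ_))
              (segment-keep (c0 <ᵇ_) j (suc j) L (<ᵇ-true c0<j) (<ᵇ-true (<-trans c0<j (n<1+n j)))))
        (any-keep (suc j <ᵇ_) (c0 <ᵇ_) (segment j (suc j) L)
                  (<ᵇ-weaken (<⇒≤ (<-trans c0<j (n<1+n j)))))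

upAt-keep : ∀ c0 j L → c0 < j → upAt j (keep (c0 <ᵇ_) L) ≡ upAt j L
upAt-keep c0 j L c0<j =
  occursBefore-keep (c0 <ᵇ_) j (suc j) L (<ᵇ-true c0<j) (<ᵇ-true (<-trans c0<j (n<1+n j)))

downAt-keep : ∀ c0 j W → c0 < j → downAt j (keep (c0 <ᵇ_) W) ≡ downAt j W
downAt-keep c0 j W c0<j = cong₂ (λ u v → u ∧ not v) (sepAt-keep c0 j W c0<j) (upAt-keep c0 j W c0<j)

interval : ℕ → ℕ → List ℕ
interval a zero    = []
interval a (suc k) = a ∷ interval (suc a) k

descending : ℕ → ℕ → List ℕ
descending a zero    = []
descending a (suc k) = (a + k) ∷ descending a k

interval-snoc : ∀ a k → interval a (suc k) ≡ interval a k ++ [ a + k ]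
interval-snoc a zero    = cong [_] (sym (+-identityʳ a))
interval-snoc a (suc k) =
  cong (a ∷_) (trans (interval-snoc (suc a) k) (cong (λ z → interval (suc a) k ++ [ z ]) (sym (+-suc a k))))

reverse-interval : ∀ a k → reverse (interval a k) ≡ descending a k
reverse-interval a zero    = refl
reverse-interval a (suc k) =
  trans (cong reverse (interval-snoc a k))
        (trans (reverse-++ (interval a k) [ a + k ]) (cong ((a + k) ∷_) (reverse-interval a k)))

interval-∈⁻ : ∀ a k {v} → v ∈ interval a k → a ≤ v × v < a + k
interval-∈⁻ a (suc k) (here refl) = ≤-refl , m<m+n a (s≤s z≤n)
interval-∈⁻ a (suc k) {v} (there p) =
  let (a<v , v<) = interval-∈⁻ (suc a) k p in <⇒≤ a<v , subst (v <_) (sym (+-suc a k)) v<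

interval-∈⁺ : ∀ a k {v} → a ≤ v → v < a + k → v ∈ interval a k
interval-∈⁺ a zero    {v} a≤v v< = ⊥-elim (<⇒≱ v< (subst (_≤ v) (sym (+-identityʳ a)) a≤v))
interval-∈⁺ a (suc k) {v} a≤v v< with v ≟ a
... | yes refl = here refl
... | no v≢a   = there (interval-∈⁺ (suc a) k (≤∧≢⇒< a≤v (λ e → v≢a (sym e))) (subst (v <_) (+-suc a k) v<))

interval-distinct : ∀ a k → Distinct (interval a k)
interval-distinct a zero    = []ᵈ
interval-distinct a (suc k) =
  (λ q → <-irrefl refl (proj₁ (interval-∈⁻ (suc a) k q))) ∷ᵈ interval-distinct (suc a) k

interval-length : ∀ a k → length (interval a k) ≡ k
interval-length a zero    = refl
interval-length a (suc k) = cong suc (interval-length (suc a) k)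

map-suc-upTo : ∀ k → map suc (upTo k) ≡ interval 1 k
map-suc-upTo k = trans (map-applyUpTo (λ x → x) suc k) (applyUpTo-interval suc 1 k (λ x → refl))
  where
  applyUpTo-interval : ∀ (f : ℕ → ℕ) a k → (∀ x → f x ≡ a + x) → applyUpTo f k ≡ interval a k
  applyUpTo-interval f a zero    h = refl
  applyUpTo-interval f a (suc k) h =
    cong₂ _∷_ (trans (h 0) (+-identityʳ a))
              (applyUpTo-interval (λ x → f (suc x)) (suc a) k (λ x → trans (h (suc x)) (+-suc a x)))

descending-∈⁻ : ∀ a k {v} → v ∈ descending a k → a ≤ v × v < a + k
descending-∈⁻ a k p = interval-∈⁻ a k (Any.reverse⁻ (subst (_ ∈_) (sym (reverse-interval a k)) p))

descending-∈⁺ : ∀ a k {v} → a ≤ v → v < a + k → v ∈ descending a k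
descending-∈⁺ a k a≤v v< = subst (_ ∈_) (reverse-interval a k) (Any.reverse⁺ (interval-∈⁺ a k a≤v v<))

descending-adjacent : ∀ a k j → a ≤ j → suc j < a + k →
  Σ (List ℕ) λ P → Σ (List ℕ) λ Q → descending a k ≡ P ++ suc j ∷ j ∷ Q
descending-adjacent a zero j a≤j j< =
  ⊥-elim (<⇒≱ j< (≤-trans (≤-reflexive (+-identityʳ a)) (≤-trans a≤j (n≤1+n j))))
descending-adjacent a (suc k) j a≤j j< with suc j ≟ a + k
descending-adjacent a (suc zero) j a≤j j< | yes e =
  ⊥-elim (<⇒≱ (s≤s a≤j) (≤-reflexive (trans e (+-identityʳ a))))
descending-adjacent a (suc (suc k)) j a≤j j< | yes e =
  [] , descending a k , sym (cong₂ (λ u v → u ∷ v ∷ descending a k) e (suc-injective (trans e (+-suc a k))))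
... | no ne =
  let (P , Q , eq) = descending-adjacent a k j a≤j (≤∧≢⇒< (≤-pred (subst (suc j <_) (+-suc a k) j<)) ne)
  in (a + k) ∷ P , Q , cong ((a + k) ∷_) eq

-- The procedure, reorganised as a left fold over the input: the state is the
-- pair (smallest value not yet output, stack), and each input entry is pushed
-- and followed by all possible pops.
passFrom : ℕ × List ℕ → List ℕ → ℕ × List ℕ
passFrom s         []       = s
passFrom (m , st) (x ∷ xs) = passFrom (popAll m (x ∷ st)) xs

pass≡passFrom : ∀ m xs st → pass m xs st ≡ passFrom (popAll m st) xs
pass≡passFrom m []       st = refl
pass≡passFrom m (x ∷ xs) st with popAll m st
... | m' , st' = pass≡passFrom m' xs (x ∷ st')

NotTop : ℕ → List ℕ → Set
NotTop a []      = ⊤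
NotTop a (t ∷ _) = t ≢ a

popRun : ∀ a T → Σ ℕ λ k → Σ (List ℕ) λ T' →
  (popAll a T ≡ (a + k , T')) × (T ≡ interval a k ++ T') × NotTop (a + k) T'
popRun a [] = 0 , [] , cong (_, []) (sym (+-identityʳ a)) , refl , tt
popRun a (t ∷ T) with t ≡ᵇ a in e
... | false = 0 , t ∷ T , cong (_, t ∷ T) (sym (+-identityʳ a)) , refl ,
              (λ t≡ → ≡ᵇ-false⁻ t a e (trans t≡ (+-identityʳ a)))
... | true with ≡ᵇ-true⁻ t a e
...   | refl with popRun (suc t) T
...     | k , T' , e₁ , e₂ , nt rewrite sym (+-suc t k) = suc k , T' , e₁ , cong (t ∷_) e₂ , nt

pushAll : ∀ m S γ R → (∀ {x} → x ∈ γ → x ≢ m) → passFrom (m , S) (γ ++ R) ≡ passFrom (m , γ ʳ++ S) R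
pushAll m S []      R h = refl
pushAll m S (x ∷ γ) R h rewrite ≡ᵇ-false x m (h (here refl)) = pushAll m (x ∷ S) γ R (λ q → h (there q))

pushBlocked : ∀ a T R → NotTop a T → (∀ {x} → x ∈ R → x ≢ a) → passFrom (a , T) R ≡ (a , R ʳ++ T)
pushBlocked a T []      nt h = refl
pushBlocked a T (x ∷ R) nt h rewrite ≡ᵇ-false x a (h (here refl)) =
  pushBlocked a (x ∷ T) R (h (here refl)) (λ q → h (there q))

false≢true : false ≢ true
false≢true ()

HoldsRange : List ℕ → ℕ → ℕ → Set
HoldsRange W m M = (∀ {v} → v ∈ W → m ≤ v × v ≤ M) × (∀ {v} → m ≤ v → v ≤ M → v ∈ W)

record FirstDown (W : List ℕ) (m M c : ℕ) : Set where
  field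
    m≤c         : m ≤ c
    c≤M         : c ≤ M
    noDownBelow : ∀ j → m ≤ j → j < c → downAt j W ≡ false
    downAtC     : c < M → downAt c W ≡ true

firstDown-≥ : ∀ {W m M c c'} → FirstDown W m M c →
  (∀ j → m ≤ j → j < c' → downAt j W ≡ false) → c' ≤ M → c' ≤ c
firstDown-≥ {c = c} {c'} fd noDown c'≤M with c' ≤? c
... | yes c'≤c = c'≤c
... | no c'≰c = let open FirstDown fd ; c<c' = ≰⇒> c'≰c in
  ⊥-elim (false≢true (trans (sym (noDown c m≤c c<c')) (downAtC (<-≤-trans c<c' c'≤M))))

firstDown-≤ : ∀ {W m M c c'} → FirstDown W m M c → m ≤ c' → downAt c' W ≡ true → c ≤ c'
firstDown-≤ {c = c} {c'} fd m≤c' down with c ≤? c'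
... | yes c≤c' = c≤c'
... | no c≰c' = let open FirstDown fd in
  ⊥-elim (false≢true (trans (sym (noDownBelow c' m≤c' (≰⇒> c≰c'))) down))

adjacent-not-down : ∀ A j C → Distinct (A ++ suc j ∷ j ∷ C) → downAt j (A ++ suc j ∷ j ∷ C) ≡ false
adjacent-not-down A j C d = let open Isolated (isolated A {suc j} {[]} {j} {C} d) in
  cong (λ z → any (suc j <ᵇ_) z ∧ not (upAt j (A ++ suc j ∷ j ∷ C)))
       (segment-split' j (suc j) A {[]} {C} (n≢1+n j) y∉A x∉A (λ ()))

-- The claim for one pass, as an invariant of the left fold: with stack S (top
-- first) and remaining input xs, let W = reverse S ++ xs hold exactly m..M with
-- m not on the stack.  Then the pass outputs m..c, c the first down pair ≥ m
-- of W, and leaves on the stack the entries of W above c, top first.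
-- (fuel bounds the length of the input and drives the induction.)
PassClaim : ℕ → Set
PassClaim fuel = ∀ m M c S xs W → W ≡ reverse S ++ xs → length xs < fuel → Distinct W →
  HoldsRange W m M → m ∉ S → m ≤ M → FirstDown W m M c →
  passFrom (m , S) xs ≡ (suc c , reverse (keep (c <ᵇ_) W))

run-decomposition : ∀ S γ₁ γ₂ m T' k → m ∷ (γ₁ ʳ++ S) ≡ interval m k ++ T' →
  reverse S ++ γ₁ ++ m ∷ γ₂ ≡ reverse T' ++ descending m k ++ γ₂
run-decomposition S γ₁ γ₂ m T' k st≡ = begin
  reverse S ++ γ₁ ++ m ∷ γ₂              ≡⟨ sym (++-assoc (reverse S) γ₁ (m ∷ γ₂)) ⟩
  (reverse S ++ γ₁) ++ m ∷ γ₂            ≡⟨ sym (++-assoc (reverse S ++ γ₁) [ m ] γ₂) ⟩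
  ((reverse S ++ γ₁) ++ [ m ]) ++ γ₂     ≡⟨ cong (λ z → (z ++ [ m ]) ++ γ₂) (sym reverse-ʳ++) ⟩
  (reverse (γ₁ ʳ++ S) ++ [ m ]) ++ γ₂    ≡⟨ cong (_++ γ₂) (sym (unfold-reverse m (γ₁ ʳ++ S))) ⟩
  reverse (m ∷ (γ₁ ʳ++ S)) ++ γ₂         ≡⟨ cong (λ z → reverse z ++ γ₂) st≡ ⟩
  reverse (interval m k ++ T') ++ γ₂     ≡⟨ cong (_++ γ₂) (reverse-++ (interval m k) T') ⟩
  (reverse T' ++ reverse (interval m k)) ++ γ₂ ≡⟨ ++-assoc (reverse T') (reverse (interval m k)) γ₂ ⟩
  reverse T' ++ reverse (interval m k) ++ γ₂   ≡⟨ cong (λ z → reverse T' ++ z ++ γ₂) (reverse-interval m k) ⟩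
  reverse T' ++ descending m k ++ γ₂     ∎
  where
  open ≡-Reasoning
  reverse-ʳ++ : reverse (γ₁ ʳ++ S) ≡ reverse S ++ γ₁
  reverse-ʳ++ = trans (cong reverse (ʳ++-defn γ₁))
                  (trans (reverse-++ (reverse γ₁) S) (cong (reverse S ++_) (reverse-involutive γ₁)))

list-empty : ∀ (L : List ℕ) → (∀ {v} → v ∈ L → ⊥) → L ≡ []
list-empty []      h = refl
list-empty (x ∷ L) h = ⊥-elim (h (here refl))

list-cons : ∀ {x : ℕ} (L : List ℕ) → x ∈ L → Σ ℕ λ t → Σ (List ℕ) λ L' → L ≡ t ∷ L'
list-cons (t ∷ L') _ = t , L' , refl

-- The pass right after the run m, …, c' = m+k0 has been output: the stack is T'
-- (its top is not c'+1) and the input is γ₂.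
module AfterRun {fuel m M c k0 : ℕ} {T' γ₂ W : List ℕ} (ih : PassClaim fuel)
  (W≡ : W ≡ reverse T' ++ descending m (suc k0) ++ γ₂) (γ₂<fuel : length γ₂ < fuel)
  (d : Distinct W) (range : HoldsRange W m M) (fd : FirstDown W m M c)
  (nt : NotTop (suc (m + k0)) T') where

  open FirstDown fd

  c' : ℕ
  c' = m + k0

  -- the remaining stack, bottom to top
  stack : List ℕ
  stack = reverse T'

  run : List ℕ
  run = descending m (suc k0)

  dW : Distinct (stack ++ run ++ γ₂)
  dW = subst Distinct W≡ d

  stack-⊆ : ∀ {v} → v ∈ stack → v ∈ W
  stack-⊆ p = subst (_ ∈_) (sym W≡) (Any.++⁺ˡ p)

  rest-⊆ : ∀ {v} → v ∈ run ++ γ₂ → v ∈ W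
  rest-⊆ p = subst (_ ∈_) (sym W≡) (Any.++⁺ʳ stack p)

  ≤M : ∀ {v} → v ∈ W → v ≤ M
  ≤M p = proj₂ (proj₁ range p)

  m≤c' : m ≤ c'
  m≤c' = m≤m+n m k0

  c'≤M : c' ≤ M
  c'≤M = ≤M (rest-⊆ (here refl))

  run-≤ : ∀ {v} → v ∈ run → v ≤ c'
  run-≤ {v} p = ≤-pred (subst (v <_) (+-suc m k0) (proj₂ (descending-∈⁻ m (suc k0) p)))

  run-∋ : ∀ {v} → m ≤ v → v ≤ c' → v ∈ run
  run-∋ {v} m≤v v≤c' = descending-∈⁺ m (suc k0) m≤v (subst (v <_) (sym (+-suc m k0)) (s≤s v≤c'))

  stack-above : ∀ {v} → v ∈ stack → c' < v
  stack-above {v} p with v ≤? c'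
  ... | no v≰c'  = ≰⇒> v≰c'
  ... | yes v≤c' = ⊥-elim (distinct-disjoint stack dW p (Any.++⁺ˡ (run-∋ (proj₁ (proj₁ range (stack-⊆ p))) v≤c')))

  input-above : ∀ {v} → v ∈ γ₂ → c' < v
  input-above {v} p with v ≤? c'
  ... | no v≰c'  = ≰⇒> v≰c'
  ... | yes v≤c' = ⊥-elim (distinct-disjoint run (distinct-++ʳ stack dW)
                     (run-∋ (proj₁ (proj₁ range (rest-⊆ (Any.++⁺ʳ run p)))) v≤c') p)

  keep-W : keep (c' <ᵇ_) W ≡ stack ++ γ₂
  keep-W = begin
    keep (c' <ᵇ_) W                                      ≡⟨ cong (keep (c' <ᵇ_)) W≡ ⟩
    keep (c' <ᵇ_) (stack ++ run ++ γ₂)                   ≡⟨ keep-++ (c' <ᵇ_) stack (run ++ γ₂) ⟩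
    keep (c' <ᵇ_) stack ++ keep (c' <ᵇ_) (run ++ γ₂)     ≡⟨ cong (keep (c' <ᵇ_) stack ++_) (keep-++ (c' <ᵇ_) run γ₂) ⟩
    keep (c' <ᵇ_) stack ++ keep (c' <ᵇ_) run ++ keep (c' <ᵇ_) γ₂
      ≡⟨ cong₂ _++_ (keep-all (c' <ᵇ_) stack (λ q → <ᵇ-true (stack-above q)))
                    (cong₂ _++_ (keep-none (c' <ᵇ_) run (λ q → <ᵇ-false (run-≤ q)))
                                (keep-all (c' <ᵇ_) γ₂ (λ q → <ᵇ-true (input-above q)))) ⟩
    stack ++ γ₂                                          ∎
    where open ≡-Reasoning

  -- Inside the descending run consecutive values are adjacent, so not separated.
  noDownInRun : ∀ j → m ≤ j → j < c' → downAt j W ≡ false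
  noDownInRun j m≤j j<c' =
    let (P , Q , run≡) = descending-adjacent m (suc k0) j m≤j (subst (suc j <_) (sym (+-suc m k0)) (s≤s j<c'))
        W≡' = trans W≡ (trans (cong (λ z → stack ++ z ++ γ₂) run≡) (regroup P Q))
    in trans (cong (downAt j) W≡') (adjacent-not-down (stack ++ P) j (Q ++ γ₂) (subst Distinct W≡' d))
    where
    regroup : ∀ P Q → stack ++ (P ++ suc j ∷ j ∷ Q) ++ γ₂ ≡ (stack ++ P) ++ suc j ∷ j ∷ (Q ++ γ₂)
    regroup P Q = trans (cong (stack ++_) (++-assoc P (suc j ∷ j ∷ Q) γ₂)) (sym (++-assoc stack P _))

  finished : ¬ suc c' ≤ M → passFrom (suc c' , T') γ₂ ≡ (suc c , reverse (keep (c <ᵇ_) W))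
  finished c'≮M = begin
    passFrom (suc c' , T') γ₂           ≡⟨ cong₂ (λ T γ → passFrom (suc c' , T) γ) T'≡[] γ₂≡[] ⟩
    (suc c' , [])                       ≡⟨ cong₂ _,_ (cong suc (sym c≡c')) (cong reverse (sym keep≡[])) ⟩
    (suc c , reverse (keep (c <ᵇ_) W))  ∎
    where
    open ≡-Reasoning
    T'≡[] : T' ≡ []
    T'≡[] = list-empty T' (λ q → c'≮M (≤-trans (stack-above (Any.reverse⁺ q)) (≤M (stack-⊆ (Any.reverse⁺ q)))))
    γ₂≡[] : γ₂ ≡ []
    γ₂≡[] = list-empty γ₂ (λ q → c'≮M (≤-trans (input-above q) (≤M (rest-⊆ (Any.++⁺ʳ run q)))))
    c≡c' : c ≡ c'
    c≡c' = ≤-antisym (≤-trans c≤M (≤-pred (≰⇒> c'≮M))) (firstDown-≥ fd noDownInRun c'≤M)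
    keep≡[] : keep (c <ᵇ_) W ≡ []
    keep≡[] = trans (cong (λ z → keep (z <ᵇ_) W) c≡c') (trans keep-W (cong₂ _++_ (cong reverse T'≡[]) γ₂≡[]))

  -- Case c'+1 is still in the input: (c', c'+1) is up, so the pass goes on
  -- with the entries above c' exactly as in a fresh instance of the claim.
  nextInInput : suc c' ≤ M → suc c' ∈ γ₂ → passFrom (suc c' , T') γ₂ ≡ (suc c , reverse (keep (c <ᵇ_) W))
  nextInInput c'<M p =
    trans (ih (suc c') M c T' γ₂ (stack ++ γ₂) refl γ₂<fuel d' range' next∉T' c'<M fd')
          (cong (λ z → suc c , reverse z) keep-keep-W)
    where
    next∉stack : suc c' ∉ stack
    next∉stack q = distinct-disjoint stack dW q (there (Any.++⁺ʳ (descending m k0) p))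
    next∉T' : suc c' ∉ T'
    next∉T' q = next∉stack (Any.reverse⁺ q)
    up : upAt c' W ≡ true
    up = trans (cong (upAt c') W≡)
               (occursBefore-split c' (suc c') stack (proj₁ (distinct-mid stack dW)) next∉stack)
    noDownUpTo : ∀ j → m ≤ j → j < suc c' → downAt j W ≡ false
    noDownUpTo j m≤j j≤c' with m≤n⇒m<n∨m≡n (≤-pred j≤c')
    ... | inj₁ j<c' = noDownInRun j m≤j j<c'
    ... | inj₂ refl = trans (cong (λ z → sepAt c' W ∧ not z) up) (∧-zeroʳ (sepAt c' W))
    c'<c : suc c' ≤ c
    c'<c = firstDown-≥ fd noDownUpTo c'<M
    m≤ : ∀ {j} → suc c' ≤ j → m ≤ j
    m≤ c'<j = ≤-trans m≤c' (≤-trans (n≤1+n c') c'<j)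
    d' : Distinct (stack ++ γ₂)
    d' = subst Distinct keep-W (distinct-keep (c' <ᵇ_) W d)
    range' : HoldsRange (stack ++ γ₂) (suc c') M
    range' = inside , complete
      where
      inside : ∀ {v} → v ∈ stack ++ γ₂ → suc c' ≤ v × v ≤ M
      inside q with Any.++⁻ stack q
      ... | inj₁ a = stack-above a , ≤M (stack-⊆ a)
      ... | inj₂ b = input-above b , ≤M (rest-⊆ (Any.++⁺ʳ run b))
      complete : ∀ {v} → suc c' ≤ v → v ≤ M → v ∈ stack ++ γ₂
      complete c'<v v≤M = subst (_ ∈_) keep-W (keep-∈⁺ (c' <ᵇ_) W (proj₂ range (m≤ c'<v) v≤M) (<ᵇ-true c'<v))
    sameDown : ∀ j → c' < j → downAt j (stack ++ γ₂) ≡ downAt j W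
    sameDown j c'<j = trans (cong (downAt j) (sym keep-W)) (downAt-keep c' j W c'<j)
    fd' : FirstDown (stack ++ γ₂) (suc c') M c
    fd' = record
      { m≤c = c'<c ; c≤M = c≤M
      ; noDownBelow = λ j c'<j j<c → trans (sameDown j c'<j) (noDownBelow j (m≤ c'<j) j<c)
      ; downAtC = λ c<M → trans (sameDown c c'<c) (downAtC c<M) }
    keep-keep-W : keep (c <ᵇ_) (stack ++ γ₂) ≡ keep (c <ᵇ_) W
    keep-keep-W = trans (cong (keep (c <ᵇ_)) (sym keep-W))
                        (keep-keep (c <ᵇ_) (c' <ᵇ_) W (<ᵇ-weaken (<⇒≤ c'<c)))

  -- If c'+1 lies inside the stack below the top entry t, then t > c'+1 sits
  -- between c'+1 and c' in W, so (c', c'+1) is down separated.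
  downWhenBuried : ∀ t T'' → T' ≡ t ∷ T'' → suc c' ∈ reverse T'' → suc c' < t → downAt c' W ≡ true
  downWhenBuried t T'' T'≡ p c'<t with ∈-∃++ p
  ... | A , B , T''≡ = cong₂ (λ u v → u ∧ not v)
          (trans (cong (any (suc c' <ᵇ_)) segment≡)
                 (any-∈ (suc c' <ᵇ_) (B ++ [ t ]) (Any.++⁺ʳ B (here refl)) (<ᵇ-true c'<t)))
          order≡
    where
    rest : List ℕ
    rest = descending m k0 ++ γ₂
    W≡' : W ≡ A ++ suc c' ∷ (B ++ [ t ]) ++ c' ∷ rest
    W≡' = begin
      W                                          ≡⟨ W≡ ⟩
      reverse T' ++ c' ∷ rest                    ≡⟨ cong (λ z → reverse z ++ c' ∷ rest) T'≡ ⟩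
      reverse (t ∷ T'') ++ c' ∷ rest             ≡⟨ cong (_++ c' ∷ rest) (unfold-reverse t T'') ⟩
      (reverse T'' ++ [ t ]) ++ c' ∷ rest        ≡⟨ cong (λ z → (z ++ [ t ]) ++ c' ∷ rest) T''≡ ⟩
      ((A ++ suc c' ∷ B) ++ [ t ]) ++ c' ∷ rest  ≡⟨ ++-assoc (A ++ suc c' ∷ B) [ t ] (c' ∷ rest) ⟩
      (A ++ suc c' ∷ B) ++ t ∷ c' ∷ rest         ≡⟨ ++-assoc A (suc c' ∷ B) (t ∷ c' ∷ rest) ⟩
      A ++ suc c' ∷ B ++ t ∷ c' ∷ rest           ≡⟨ cong (λ z → A ++ suc c' ∷ z) (sym (++-assoc B [ t ] (c' ∷ rest))) ⟩
      A ++ suc c' ∷ (B ++ [ t ]) ++ c' ∷ rest    ∎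
      where open ≡-Reasoning
    open Isolated (isolated A {suc c'} {B ++ [ t ]} {c'} {rest} (subst Distinct W≡' d))
    segment≡ : segment c' (suc c') W ≡ B ++ [ t ]
    segment≡ = trans (cong (segment c' (suc c')) W≡') (segment-split' c' (suc c') A (n≢1+n c') y∉A x∉A y∉B)
    order≡ : upAt c' W ≡ false
    order≡ = trans (cong (upAt c') W≡') (occursBefore-split' c' (suc c') A (n≢1+n c') y∉A x∉A)

  nextOnStack : suc c' ∈ stack → passFrom (suc c' , T') γ₂ ≡ (suc c , reverse (keep (c <ᵇ_) W))
  nextOnStack p with list-cons T' (Any.reverse⁻ p)
  ... | t , T'' , T'≡ = begin
    passFrom (suc c' , T') γ₂           ≡⟨ pushBlocked (suc c') T' γ₂ nt input≢ ⟩
    (suc c' , γ₂ ʳ++ T')                ≡⟨ cong₂ _,_ (cong suc (sym c≡c')) remaining≡ ⟩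
    (suc c , reverse (keep (c <ᵇ_) W))  ∎
    where
    open ≡-Reasoning
    t≢ : t ≢ suc c'
    t≢ = subst (NotTop (suc c')) T'≡ nt
    stack≡ : stack ≡ reverse T'' ++ [ t ]
    stack≡ = trans (cong reverse T'≡) (unfold-reverse t T'')
    c'<t : suc c' < t
    c'<t = ≤∧≢⇒< (stack-above (subst (t ∈_) (sym stack≡) (Any.++⁺ʳ (reverse T'') (here refl))))
                 (λ e → t≢ (sym e))
    buried : suc c' ∈ reverse T''
    buried with Any.++⁻ (reverse T'') (subst (suc c' ∈_) stack≡ p)
    ... | inj₁ q = q
    ... | inj₂ (here e) = ⊥-elim (t≢ (sym e))
    c≡c' : c ≡ c'
    c≡c' = ≤-antisym (firstDown-≤ fd m≤c' (downWhenBuried t T'' T'≡ buried c'<t))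
                     (firstDown-≥ fd noDownInRun c'≤M)
    input≢ : ∀ {x} → x ∈ γ₂ → x ≢ suc c'
    input≢ q e = distinct-disjoint stack dW p (there (Any.++⁺ʳ (descending m k0) (subst (_∈ γ₂) e q)))
    remaining≡ : γ₂ ʳ++ T' ≡ reverse (keep (c <ᵇ_) W)
    remaining≡ = begin
      γ₂ ʳ++ T'                        ≡⟨ ʳ++-defn γ₂ ⟩
      reverse γ₂ ++ T'                 ≡⟨ cong (reverse γ₂ ++_) (sym (reverse-involutive T')) ⟩
      reverse γ₂ ++ reverse stack      ≡⟨ sym (reverse-++ stack γ₂) ⟩
      reverse (stack ++ γ₂)            ≡⟨ cong reverse (sym keep-W) ⟩
      reverse (keep (c' <ᵇ_) W)        ≡⟨ cong (λ z → reverse (keep (z <ᵇ_) W)) (sym c≡c') ⟩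
      reverse (keep (c <ᵇ_) W)         ∎

  result : passFrom (suc c' , T') γ₂ ≡ (suc c , reverse (keep (c <ᵇ_) W))
  result with suc c' ≤? M
  ... | no c'≮M = finished c'≮M
  ... | yes c'<M with Any.++⁻ stack (subst (suc c' ∈_) W≡ (proj₂ range (≤-trans m≤c' (n≤1+n c')) c'<M))
  ...   | inj₁ p = nextOnStack p
  ...   | inj₂ q with Any.++⁻ run q
  ...     | inj₁ r = ⊥-elim (<-irrefl refl (run-≤ r))
  ...     | inj₂ p = nextInInput c'<M p

min-in-input : ∀ {m : ℕ} S xs → m ∈ reverse S ++ xs → m ∉ S → m ∈ xs
min-in-input S xs p m∉S with Any.++⁻ (reverse S) p
... | inj₁ q = ⊥-elim (m∉S (Any.reverse⁻ q))
... | inj₂ q = q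

-- Induction step: push up to m, pop the maximal run m, …, m+k0, and continue.
passStep : ∀ {fuel} → PassClaim fuel → PassClaim (suc fuel)
passStep {fuel} ih m M c S xs W W≡ xs<fuel d range m∉S m≤M fd
  with ∈-∃++ (min-in-input S xs (subst (m ∈_) W≡ (proj₂ range ≤-refl m≤M)) m∉S)
... | γ₁ , γ₂ , refl with popRun m (m ∷ (γ₁ ʳ++ S))
...   | zero , T' , _ , st≡ , nt = ⊥-elim (subst (NotTop (m + 0)) (sym st≡) nt (sym (+-identityʳ m)))
...   | suc k0 , T' , pop≡ , st≡ , nt = begin
  passFrom (m , S) (γ₁ ++ m ∷ γ₂)             ≡⟨ pushAll m S γ₁ (m ∷ γ₂) γ₁≢m ⟩
  passFrom (popAll m (m ∷ (γ₁ ʳ++ S))) γ₂    ≡⟨ cong (λ z → passFrom z γ₂) (trans pop≡ (cong (_, T') (+-suc m k0))) ⟩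
  passFrom (suc (m + k0) , T') γ₂            ≡⟨ AfterRun.result ih W≡' γ₂<fuel d range fd nt' ⟩
  (suc c , reverse (keep (c <ᵇ_) W))         ∎
  where
  open ≡-Reasoning
  W≡' : W ≡ reverse T' ++ descending m (suc k0) ++ γ₂
  W≡' = trans W≡ (run-decomposition S γ₁ γ₂ m T' (suc k0) st≡)
  γ₁≢m : ∀ {x} → x ∈ γ₁ → x ≢ m
  γ₁≢m q refl = proj₁ (distinct-mid (reverse S ++ γ₁) (subst Distinct (trans W≡ (sym (++-assoc (reverse S) γ₁ _))) d))
                      (Any.++⁺ʳ (reverse S) q)
  γ₂<fuel : length γ₂ < fuel
  γ₂<fuel = ≤-trans (subst (suc (length γ₂) ≤_) (sym (length-++ γ₁)) (m≤n+m (suc (length γ₂)) (length γ₁))) (≤-pred xs<fuel)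
  nt' : NotTop (suc (m + k0)) T'
  nt' = subst (λ z → NotTop z T') (+-suc m k0) nt

passLemma : ∀ fuel → PassClaim fuel
passLemma zero       m M c S xs W _ () 
passLemma (suc fuel) = passStep (passLemma fuel)

-- Each pass reads the surviving entries either in the order of σ or reversed.
orient : Bool → List ℕ → List ℕ
orient false L = L
orient true  L = reverse L

orient-∈⁺ : ∀ rev L {v} → v ∈ L → v ∈ orient rev L
orient-∈⁺ false L p = p
orient-∈⁺ true  L p = Any.reverse⁺ p

orient-∈⁻ : ∀ rev L {v} → v ∈ orient rev L → v ∈ L
orient-∈⁻ false L p = p
orient-∈⁻ true  L p = Any.reverse⁻ p

orient-distinct : ∀ rev L → Distinct L → Distinct (orient rev L)
orient-distinct false L d = d
orient-distinct true  L d = distinct-reverse L d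

orient-nil : ∀ rev → orient rev [] ≡ []
orient-nil false = refl
orient-nil true  = refl

-- (j, j+1) is down separated in orient rev σ.
blocksAt : List ℕ → Bool → ℕ → Bool
blocksAt σ rev j = sepAt j σ ∧ not (rev xor upAt j σ)

downAt-input : ∀ σ rev c0 j → Distinct σ → j ∈ σ → suc j ∈ σ → c0 < j →
  downAt j (orient rev (keep (c0 <ᵇ_) σ)) ≡ blocksAt σ rev j
downAt-input σ false c0 j d a b c0<j = downAt-keep c0 j σ c0<j
downAt-input σ true  c0 j d a b c0<j =
  cong₂ (λ u v → u ∧ not v) (trans (sepAt-reverse j K dK aK bK) (sepAt-keep c0 j σ c0<j))
                            (trans (upAt-reverse j K dK aK bK) (cong not (upAt-keep c0 j σ c0<j)))
  where
  K : List ℕ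
  K = keep (c0 <ᵇ_) σ
  dK : Distinct K
  dK = distinct-keep (c0 <ᵇ_) σ d
  aK : j ∈ K
  aK = keep-∈⁺ (c0 <ᵇ_) σ a (<ᵇ-true c0<j)
  bK : suc j ∈ K
  bK = keep-∈⁺ (c0 <ᵇ_) σ b (<ᵇ-true (<-trans c0<j (n<1+n j)))

-- The stack left by a pass, read top to bottom, is the next input in the opposite orientation.
keep-orient : ∀ σ rev c0 c → c0 ≤ c →
  reverse (keep (c <ᵇ_) (orient rev (keep (c0 <ᵇ_) σ))) ≡ orient (not rev) (keep (c <ᵇ_) σ)
keep-orient σ false c0 c c0≤c = cong reverse (keep-keep (c <ᵇ_) (c0 <ᵇ_) σ (<ᵇ-weaken c0≤c))
keep-orient σ true  c0 c c0≤c =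
  trans (cong reverse (keep-reverse (c <ᵇ_) (keep (c0 <ᵇ_) σ)))
        (trans (reverse-involutive _) (keep-keep (c <ᵇ_) (c0 <ᵇ_) σ (<ᵇ-weaken c0≤c)))

runTier-done : ∀ f m inp a → pass m inp [] ≡ (a , []) → runTier f m inp ≡ just 0
runTier-done f m inp a e with pass m inp [] | e
... | _ | refl = refl

runTier-step : ∀ f m inp a s st t → pass m inp [] ≡ (a , s ∷ st) →
  runTier f a (s ∷ st) ≡ just t → runTier (suc f) m inp ≡ just (suc t)
runTier-step f m inp a s st t e r with pass m inp [] | e
... | _ | refl rewrite r = refl

<-of-sum : ∀ i k {n} → i + suc k ≡ n → i < n
<-of-sum i k i+k≡n = subst (i <_) i+k≡n (m<m+n i (s≤s z≤n))

-- The returns still to come, counted by scanning the candidate pairs in order: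
-- a pair that blocks the current pass ends it, and the next pass reads the
-- surviving entries in the opposite orientation.
tierScan : List ℕ → Bool → List ℕ → ℕ
tierScan σ rev []       = 0
tierScan σ rev (i ∷ is) = if blocksAt σ rev i then suc (tierScan σ (not rev) is) else tierScan σ rev is

-- The run of the procedure on a permutation σ of 1..n.  After the values
-- 1..c0 have been output, the input is orient rev (entries of σ above c0).
module Run (σ : List ℕ) (n : ℕ) (d : Distinct σ) (range : HoldsRange σ 1 n) where

  input : Bool → ℕ → List ℕ
  input rev c0 = orient rev (keep (c0 <ᵇ_) σ)

  σ-∋ : ∀ {v} → 1 ≤ v → v ≤ n → v ∈ σ
  σ-∋ = proj₂ range

  input-range : ∀ rev c0 → HoldsRange (input rev c0) (suc c0) n
  input-range rev c0 = inside , complete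
    where
    inside : ∀ {v} → v ∈ input rev c0 → suc c0 ≤ v × v ≤ n
    inside q = let (a , b) = keep-∈⁻ (c0 <ᵇ_) σ (orient-∈⁻ rev _ q) in <ᵇ-true⁻ b , proj₂ (proj₁ range a)
    complete : ∀ {v} → suc c0 ≤ v → v ≤ n → v ∈ input rev c0
    complete c0<v v≤n = orient-∈⁺ rev _ (keep-∈⁺ (c0 <ᵇ_) σ (σ-∋ (≤-trans (s≤s z≤n) c0<v) v≤n) (<ᵇ-true c0<v))

  input-distinct : ∀ rev c0 → Distinct (input rev c0)
  input-distinct rev c0 = orient-distinct rev _ (distinct-keep (c0 <ᵇ_) σ d)

  passResult : ∀ rev c0 c → suc c0 ≤ c → c ≤ n →
    (∀ j → suc c0 ≤ j → j < c → blocksAt σ rev j ≡ false) → (c < n → blocksAt σ rev c ≡ true) →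
    pass (suc c0) (input rev c0) [] ≡ (suc c , orient (not rev) (keep (c <ᵇ_) σ))
  passResult rev c0 c c0<c c≤n noBlock block =
    trans (pass≡passFrom (suc c0) (input rev c0) [])
      (trans (passLemma (suc (length (input rev c0))) (suc c0) n c [] (input rev c0) (input rev c0) refl (n<1+n _)
                        (input-distinct rev c0) (input-range rev c0) (λ ()) (≤-trans c0<c c≤n) fd)
             (cong (suc c ,_) (keep-orient σ rev c0 c (≤-trans (n≤1+n c0) c0<c))))
    where
    sameDown : ∀ j → c0 < j → j < n → downAt j (input rev c0) ≡ blocksAt σ rev j
    sameDown j c0<j j<n = downAt-input σ rev c0 j d (σ-∋ (≤-trans (s≤s z≤n) c0<j) (<⇒≤ j<n)) (σ-∋ (s≤s z≤n) j<n) c0<j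
    fd : FirstDown (input rev c0) (suc c0) n c
    fd = record
      { m≤c = c0<c ; c≤M = c≤n
      ; noDownBelow = λ j c0<j j<c → trans (sameDown j c0<j (<-≤-trans j<c c≤n)) (noBlock j c0<j j<c)
      ; downAtC = λ c<n → trans (sameDown c c0<c c<n) (block c<n) }

  runTier-scan : ∀ fuel c0 rev i k → suc c0 ≤ i → i + k ≡ n → n ≤ c0 + fuel →
    (∀ j → suc c0 ≤ j → j < i → blocksAt σ rev j ≡ false) →
    runTier fuel (suc c0) (input rev c0) ≡ just (tierScan σ rev (interval i k))
  runTier-scan fuel c0 rev i zero c0<i i+0≡n n≤ noBlock =
    runTier-done fuel (suc c0) (input rev c0) (suc n)
      (trans (passResult rev c0 n (subst (suc c0 ≤_) i≡n c0<i) ≤-refl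
                         (λ j a b → noBlock j a (subst (j <_) (sym i≡n) b)) (λ n<n → ⊥-elim (<-irrefl refl n<n)))
             (cong (suc n ,_) (trans (cong (orient (not rev)) (keep-none (n <ᵇ_) σ (λ q → <ᵇ-false (proj₂ (proj₁ range q)))))
                                     (orient-nil (not rev)))))
    where
    i≡n : i ≡ n
    i≡n = trans (sym (+-identityʳ i)) i+0≡n
  runTier-scan zero c0 rev i (suc k) c0<i i+k≡n n≤ noBlock =
    ⊥-elim (<⇒≱ (≤-trans c0<i (≤-trans (m≤m+n i (suc k)) (≤-reflexive i+k≡n))) (≤-trans n≤ (≤-reflexive (+-identityʳ c0))))
  runTier-scan (suc f) c0 rev i (suc k) c0<i i+k≡n n≤ noBlock with blocksAt σ rev i in e
  ... | false = runTier-scan (suc f) c0 rev (suc i) k (≤-trans c0<i (n≤1+n i)) (trans (sym (+-suc i k)) i+k≡n) n≤ noBlock'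
    where
    noBlock' : ∀ j → suc c0 ≤ j → j < suc i → blocksAt σ rev j ≡ false
    noBlock' j a b with m≤n⇒m<n∨m≡n (≤-pred b)
    ... | inj₁ j<i = noBlock j a j<i
    ... | inj₂ refl = e
  ... | true with list-cons (orient (not rev) (keep (i <ᵇ_) σ))
                            (orient-∈⁺ (not rev) _ (keep-∈⁺ (i <ᵇ_) σ (σ-∋ (≤-trans (s≤s z≤n) i<n) ≤-refl) (<ᵇ-true i<n)))
    where
    i<n : i < n
    i<n = <-of-sum i k i+k≡n
  ...   | s , st , stack≡ =
    runTier-step f (suc c0) (input rev c0) (suc i) s st (tierScan σ (not rev) (interval (suc i) k))
      (trans (passResult rev c0 i c0<i (<⇒≤ i<n) noBlock (λ _ → e)) (cong (suc i ,_) stack≡))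
      (subst (λ z → runTier f (suc i) z ≡ just (tierScan σ (not rev) (interval (suc i) k))) stack≡
             (runTier-scan f i (not rev) (suc i) k ≤-refl (trans (sym (+-suc i k)) i+k≡n) n≤' (λ j a b → ⊥-elim (<⇒≱ b a))))
    where
    i<n : i < n
    i<n = <-of-sum i k i+k≡n
    n≤' : n ≤ i + f
    n≤' = ≤-trans n≤ (≤-trans (≤-reflexive (+-suc c0 f)) (+-monoˡ-≤ f c0<i))

PairList : Set
PairList = List (ℕ × Bool)

sepPairsOn : List ℕ → List ℕ → PairList
sepPairsOn σ is = map (λ i → i , isUp σ i) (filter (λ i → T? (separated σ i)) is)

sepPairs≡ : ∀ σ → sepPairs σ ≡ sepPairsOn σ (interval 1 (length σ ∸ 1))
sepPairs≡ σ = cong (sepPairsOn σ) (map-suc-upTo (length σ ∸ 1))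

greedyAlt : Bool → PairList → ℕ
greedyAlt c []             = 0
greedyAlt c ((_ , o) ∷ L) = if c xor o then greedyAlt c L else suc (greedyAlt (not c) L)

-- A pair blocks the current pass exactly when the greedy scan takes it.
tierScan≡greedyAlt : ∀ σ rev is → tierScan σ rev is ≡ greedyAlt rev (sepPairsOn σ is)
tierScan≡greedyAlt σ rev [] = refl
tierScan≡greedyAlt σ rev (i ∷ is) with separated σ i in es
... | false rewrite sym (separated≡sepAt σ i) | es = tierScan≡greedyAlt σ rev is
... | true rewrite sym (separated≡sepAt σ i) | es | sym (isUp≡upAt σ i) with rev xor isUp σ i
...   | true  = tierScan≡greedyAlt σ rev is
...   | false = cong suc (tierScan≡greedyAlt σ (not rev) is)

revTier-formula : ∀ τ n' → Distinct τ → HoldsRange τ 1 (suc n') → length τ ≡ suc n' →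
  revTier τ ≡ just (greedyAlt false (sepPairs τ))
revTier-formula τ n' d range len = begin
  runTier (length τ) 1 τ                         ≡⟨ cong (runTier (length τ) 1) (sym keep≡τ) ⟩
  runTier (length τ) 1 (keep (0 <ᵇ_) τ)          ≡⟨ Run.runTier-scan τ (suc n') d range (length τ) 0 false 1 n'
                                                      ≤-refl refl (≤-reflexive (sym len)) (λ j a b → ⊥-elim (<⇒≱ b a)) ⟩
  just (tierScan τ false (interval 1 n'))        ≡⟨ cong just (tierScan≡greedyAlt τ false (interval 1 n')) ⟩
  just (greedyAlt false (sepPairsOn τ (interval 1 n')))
    ≡⟨ cong (λ z → just (greedyAlt false z)) (sym (trans (sepPairs≡ τ) (cong (λ z → sepPairsOn τ (interval 1 (z ∸ 1))) len))) ⟩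
  just (greedyAlt false (sepPairs τ))            ∎
  where
  open ≡-Reasoning
  keep≡τ : keep (0 <ᵇ_) τ ≡ τ
  keep≡τ = keep-all (0 <ᵇ_) τ (λ q → <ᵇ-true (proj₁ (proj₁ range q)))

greedyAltSeq : Bool → PairList → PairList
greedyAltSeq c []             = []
greedyAltSeq c ((i , o) ∷ L) = if c xor o then greedyAltSeq c L else (i , o) ∷ greedyAltSeq (not c) L

greedyAlt-step : ∀ c L → greedyAlt c L ≤ suc (greedyAlt (not c) L)
greedyAlt-step c     []                 = z≤n
greedyAlt-step true  ((_ , true) ∷ L)  = ≤-refl
greedyAlt-step true  ((_ , false) ∷ L) = ≤-trans (n≤1+n _) (n≤1+n _)
greedyAlt-step false ((_ , false) ∷ L) = ≤-refl
greedyAlt-step false ((_ , true) ∷ L)  = ≤-trans (n≤1+n _) (n≤1+n _)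

greedyAlt-mono : ∀ c x L → greedyAlt c L ≤ greedyAlt c (x ∷ L)
greedyAlt-mono true  (_ , true)  L = greedyAlt-step true L
greedyAlt-mono true  (_ , false) L = ≤-refl
greedyAlt-mono false (_ , false) L = greedyAlt-step false L
greedyAlt-mono false (_ , true)  L = ≤-refl

alternating-bound : ∀ L j c s' → ((j , c) ∷ s') ∈ sublists L → alternating ((j , c) ∷ s') ≡ true →
  suc (length s') ≤ greedyAlt c L
alternating-tail-bound : ∀ L j c s' → s' ∈ sublists L → alternating ((j , c) ∷ s') ≡ true →
  length s' ≤ greedyAlt (not c) L
alternating-bound [] j c s' (here ()) alt
alternating-bound [] j c s' (there ()) alt
alternating-bound (x ∷ L) j c s' p alt with Any.++⁻ (map (x ∷_) (sublists L)) p
... | inj₂ q = ≤-trans (alternating-bound L j c s' q alt) (greedyAlt-mono c x L)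
... | inj₁ q with ∈-map⁻ (x ∷_) q
...   | y , y∈ , refl with c
...     | true  = s≤s (alternating-tail-bound L j true s' y∈ alt)
...     | false = s≤s (alternating-tail-bound L j false s' y∈ alt)
alternating-tail-bound L j c     []                  q alt = z≤n
alternating-tail-bound L j true  ((j' , false) ∷ s'') q alt = alternating-bound L j' false s'' q alt
alternating-tail-bound L j false ((j' , true) ∷ s'')  q alt = alternating-bound L j' true s'' q alt
alternating-tail-bound L j true  ((j' , true) ∷ s'')  q ()
alternating-tail-bound L j false ((j' , false) ∷ s'') q ()

greedyAltSeq-length : ∀ c L → length (greedyAltSeq c L) ≡ greedyAlt c L
greedyAltSeq-length c     []                 = refl
greedyAltSeq-length true  ((_ , true) ∷ L)  = cong suc (greedyAltSeq-length false L)
greedyAltSeq-length true  ((_ , false) ∷ L) = greedyAltSeq-length true L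
greedyAltSeq-length false ((_ , false) ∷ L) = cong suc (greedyAltSeq-length true L)
greedyAltSeq-length false ((_ , true) ∷ L)  = greedyAltSeq-length false L

greedyAltSeq-sublist : ∀ c L → greedyAltSeq c L ∈ sublists L
greedyAltSeq-sublist c     []                 = here refl
greedyAltSeq-sublist true  ((i , true) ∷ L)  = Any.++⁺ˡ (∈-map⁺ ((i , true) ∷_) (greedyAltSeq-sublist false L))
greedyAltSeq-sublist true  ((i , false) ∷ L) = Any.++⁺ʳ (map ((i , false) ∷_) (sublists L)) (greedyAltSeq-sublist true L)
greedyAltSeq-sublist false ((i , false) ∷ L) = Any.++⁺ˡ (∈-map⁺ ((i , false) ∷_) (greedyAltSeq-sublist true L))
greedyAltSeq-sublist false ((i , true) ∷ L)  = Any.++⁺ʳ (map ((i , true) ∷_) (sublists L)) (greedyAltSeq-sublist false L)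

HeadIs : Bool → PairList → Set
HeadIs c []             = ⊤
HeadIs c ((_ , o) ∷ _) = o ≡ c

alternating-cons : ∀ i o G → alternating G ≡ true → HeadIs (not o) G → alternating ((i , o) ∷ G) ≡ true
alternating-cons i o     []                 alt h  = refl
alternating-cons i true  ((j , false) ∷ G) alt h  = alt
alternating-cons i false ((j , true) ∷ G)  alt h  = alt
alternating-cons i true  ((j , true) ∷ G)  alt ()
alternating-cons i false ((j , false) ∷ G) alt ()

greedyAltSeq-alternating : ∀ c L → (alternating (greedyAltSeq c L) ≡ true) × HeadIs c (greedyAltSeq c L)
greedyAltSeq-alternating c [] = refl , tt
greedyAltSeq-alternating true ((i , true) ∷ L) =
  let (alt , h) = greedyAltSeq-alternating false L in alternating-cons i true _ alt h , refl
greedyAltSeq-alternating true ((i , false) ∷ L) = greedyAltSeq-alternating true L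
greedyAltSeq-alternating false ((i , false) ∷ L) =
  let (alt , h) = greedyAltSeq-alternating true L in alternating-cons i false _ alt h , refl
greedyAltSeq-alternating false ((i , true) ∷ L) = greedyAltSeq-alternating false L

maxLen-lub : ∀ (I : List PairList) B → (∀ {s} → s ∈ I → length s ≤ B) → maxLen I ≤ B
maxLen-lub []      B h = z≤n
maxLen-lub (s ∷ I) B h = ⊔-lub (h (here refl)) (maxLen-lub I B (λ q → h (there q)))

maxLen-ub : ∀ (I : List PairList) {s} → s ∈ I → length s ≤ maxLen I
maxLen-ub (s ∷ I) (here refl) = m≤m⊔n (length s) (maxLen I)
maxLen-ub (s ∷ I) (there q)   = ≤-trans (maxLen-ub I q) (m≤n⊔m (length s) (maxLen I))

all-true : ∀ (p : PairList → Bool) xs → (∀ {x} → x ∈ xs → p x ≡ true) → all p xs ≡ true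
all-true p []       h = refl
all-true p (x ∷ xs) h rewrite h (here refl) = all-true p xs (λ q → h (there q))

all-false : ∀ (p : PairList → Bool) xs {x} → x ∈ xs → p x ≡ false → all p xs ≡ false
all-false p (x ∷ xs) (here refl) e rewrite e = refl
all-false p (y ∷ xs) (there q)   e rewrite all-false p xs q e = ∧-zeroʳ (p y)

isaspsOf : PairList → List PairList
isaspsOf L = filter (λ s → T? (not (null s) ∧ alternating s)) (sublists L)

isaspsOf-∈⁻ : ∀ L {s} → s ∈ isaspsOf L → s ∈ sublists L × (not (null s) ∧ alternating s) ≡ true
isaspsOf-∈⁻ L q = let (a , b) = ∈-filter⁻ (λ s → T? (not (null s) ∧ alternating s)) q in a , Equivalence.to T-≡ b

greedy-isasp : ∀ i o L' → greedyAltSeq o ((i , o) ∷ L') ∈ isaspsOf ((i , o) ∷ L')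
greedy-isasp i true L' = ∈-filter⁺ (λ s → T? (not (null s) ∧ alternating s)) (greedyAltSeq-sublist true ((i , true) ∷ L'))
                           (Equivalence.from T-≡ (proj₁ (greedyAltSeq-alternating true ((i , true) ∷ L'))))
greedy-isasp i false L' = ∈-filter⁺ (λ s → T? (not (null s) ∧ alternating s)) (greedyAltSeq-sublist false ((i , false) ∷ L'))
                            (Equivalence.from T-≡ (proj₁ (greedyAltSeq-alternating false ((i , false) ∷ L'))))

greedyAlt-head : ∀ i o L' → greedyAlt o ((i , o) ∷ L') ≡ suc (greedyAlt (not o) L')
greedyAlt-head i true  L' = refl
greedyAlt-head i false L' = refl

greedyAlt-cons-≤ : ∀ i o L' c → greedyAlt c ((i , o) ∷ L') ≤ suc (greedyAlt (not o) L')
greedyAlt-cons-≤ i true  L' true  = ≤-refl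
greedyAlt-cons-≤ i false L' true  = n≤1+n _
greedyAlt-cons-≤ i false L' false = ≤-refl
greedyAlt-cons-≤ i true  L' false = n≤1+n _

-- Starting against the first pair's orientation loses that pair.
greedyAlt-cons-< : ∀ i o L' c → c xor o ≡ true → greedyAlt c ((i , o) ∷ L') < suc (greedyAlt (not o) L')
greedyAlt-cons-< i false L' true  e = ≤-refl
greedyAlt-cons-< i true  L' false e = ≤-refl

maxLen-isasps : ∀ i o L' → maxLen (isaspsOf ((i , o) ∷ L')) ≡ suc (greedyAlt (not o) L')
maxLen-isasps i o L' =
  ≤-antisym (maxLen-lub (isaspsOf L) B bounded)
            (subst (_≤ maxLen (isaspsOf L)) greedy-length (maxLen-ub (isaspsOf L) (greedy-isasp i o L')))
  where
  L : PairList
  L = (i , o) ∷ L'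
  B : ℕ
  B = suc (greedyAlt (not o) L')
  greedy-length : length (greedyAltSeq o L) ≡ B
  greedy-length = trans (greedyAltSeq-length o L) (greedyAlt-head i o L')
  bounded : ∀ {s} → s ∈ isaspsOf L → length s ≤ B
  bounded {[]}          q = z≤n
  bounded {(j , c) ∷ s'} q = let (a , b) = isaspsOf-∈⁻ L q in
    ≤-trans (alternating-bound L j c s' a b) (greedyAlt-cons-≤ i o L' c)

startsWith-same : ∀ b c o {j i : ℕ} {s' L' : PairList} → c xor o ≡ false →
  startsWith b ((j , c) ∷ s') ≡ startsWith b ((i , o) ∷ L')
startsWith-same b true  true  e = refl
startsWith-same b false false e = refl

greedy-isasp-head : ∀ b i o L' → startsWith b (greedyAltSeq o ((i , o) ∷ L')) ≡ startsWith b ((i , o) ∷ L')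
greedy-isasp-head b i true  L' = refl
greedy-isasp-head b i false L' = refl

orientedOn : Bool → PairList → Bool
orientedOn b L = not (null L) ∧ all (λ s → not (length s ≡ᵇ maxLen (isaspsOf L)) ∨ startsWith b s) (isaspsOf L)

orientedOn-head : ∀ b L → orientedOn b L ≡ startsWith b L
orientedOn-head b []             = refl
orientedOn-head b ((i , o) ∷ L') with startsWith b ((i , o) ∷ L') in head≡
... | false = all-false _ (isaspsOf L) (greedy-isasp i o L')
      (cong₂ (λ u v → not u ∨ v)
        (trans (cong₂ _≡ᵇ_ (trans (greedyAltSeq-length o L) (greedyAlt-head i o L')) (maxLen-isasps i o L')) (≡ᵇ-refl (suc (greedyAlt (not o) L'))))
        (trans (greedy-isasp-head b i o L') head≡))
  where
  L : PairList
  L = (i , o) ∷ L'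
... | true = all-true _ (isaspsOf L) maximal-starts
  where
  L : PairList
  L = (i , o) ∷ L'
  maximal-starts : ∀ {s} → s ∈ isaspsOf L → (not (length s ≡ᵇ maxLen (isaspsOf L)) ∨ startsWith b s) ≡ true
  maximal-starts {[]} q = ⊥-elim (false≢true (proj₂ (isaspsOf-∈⁻ L q)))
  maximal-starts {(j , c) ∷ s'} q with c xor o in e
  ... | false = trans (cong (not (length ((j , c) ∷ s') ≡ᵇ maxLen (isaspsOf L)) ∨_)
                            (trans (startsWith-same b c o {j} {i} {s'} {L'} e) head≡)) (∨-zeroʳ _)
  ... | true = cong (λ z → not z ∨ startsWith b ((j , c) ∷ s'))
                 (≡ᵇ-false _ _ (<⇒≢ (subst (length ((j , c) ∷ s') <_) (sym (maxLen-isasps i o L'))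
                   (≤-<-trans (alternating-bound L j c s' (proj₁ (isaspsOf-∈⁻ L q)) (proj₂ (isaspsOf-∈⁻ L q)))
                              (greedyAlt-cons-< i o L' c e)))))

oriented-head : ∀ b σ → oriented b σ ≡ startsWith b (sepPairs σ)
oriented-head b σ = orientedOn-head b (sepPairs σ)

insertAll-↭ : ∀ x ys {σ} → σ ∈ insertAll x ys → σ ↭ x ∷ ys
insertAll-↭ x []       (here refl) = ↭-refl
insertAll-↭ x (y ∷ ys) (here refl) = ↭-refl
insertAll-↭ x (y ∷ ys) (there p) with ∈-map⁻ (y ∷_) p
... | τ , q , refl = ↭-trans (prep y (insertAll-↭ x ys q)) (swap y x ↭-refl)

perms-↭ : ∀ n {σ} → σ ∈ perms n → σ ↭ interval 1 n
perms-↭ zero    (here refl) = ↭-refl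
perms-↭ (suc n) p with find (∈-concatMap⁻ (insertAll (suc n)) p)
... | τ , τ∈ , σ∈ =
  ↭-trans (insertAll-↭ (suc n) τ σ∈)
    (↭-trans (prep (suc n) (perms-↭ n τ∈))
      (↭-trans (↭-sym (++-comm (interval 1 n) [ suc n ])) (↭-reflexive (sym (interval-snoc 1 n)))))

record IsPermutation (σ : List ℕ) (n : ℕ) : Set where
  field
    distinct : Distinct σ
    range    : HoldsRange σ 1 n
    len      : length σ ≡ n

perms-isPermutation : ∀ n {σ} → σ ∈ perms n → IsPermutation σ n
perms-isPermutation n {σ} p = record
  { distinct = distinct-↭ (↭-sym σ↭) (interval-distinct 1 n)
  ; range    = (λ q → let (a , b) = interval-∈⁻ 1 n (∈-resp-↭ σ↭ q) in a , ≤-pred b) ,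
               (λ a b → ∈-resp-↭ (↭-sym σ↭) (interval-∈⁺ 1 n a (s≤s b)))
  ; len      = trans (↭-length σ↭) (interval-length 1 n) }
  where
  σ↭ : σ ↭ interval 1 n
  σ↭ = perms-↭ n p

reverse-isPermutation : ∀ {σ n} → IsPermutation σ n → IsPermutation (reverse σ) n
reverse-isPermutation {σ} P = let open IsPermutation P in record
  { distinct = distinct-reverse σ distinct
  ; range    = (λ q → proj₁ range (Any.reverse⁻ q)) , (λ a b → Any.reverse⁺ (proj₂ range a b))
  ; len      = trans (length-reverse σ) len }

insertAll-snoc : ∀ x ys y → insertAll x (ys ++ [ y ]) ≡ map (_++ [ y ]) (insertAll x ys) ++ [ ys ++ y ∷ x ∷ [] ]
insertAll-snoc x []       y = refl
insertAll-snoc x (z ∷ ys) y = cong ((x ∷ z ∷ ys ++ [ y ]) ∷_)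
  (trans (cong (map (z ∷_)) (insertAll-snoc x ys y))
    (trans (map-++ (z ∷_) (map (_++ [ y ]) (insertAll x ys)) [ ys ++ y ∷ x ∷ [] ])
      (cong (_++ [ z ∷ ys ++ y ∷ x ∷ [] ]) (trans (sym (map-∘ (insertAll x ys))) (map-∘ (insertAll x ys))))))

reverse-insertAll : ∀ x ys → map reverse (insertAll x ys) ≡ reverse (insertAll x (reverse ys))
reverse-insertAll x []       = refl
reverse-insertAll x (y ∷ ys) = begin
  reverse (x ∷ y ∷ ys) ∷ map reverse (map (y ∷_) (insertAll x ys))
    ≡⟨ cong₂ _∷_ first rest ⟩
  (reverse ys ++ y ∷ x ∷ []) ∷ map (_++ [ y ]) (reverse (insertAll x (reverse ys)))
    ≡⟨ cong ((reverse ys ++ y ∷ x ∷ []) ∷_) (reverse-map (_++ [ y ]) (insertAll x (reverse ys))) ⟩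
  (reverse ys ++ y ∷ x ∷ []) ∷ reverse (map (_++ [ y ]) (insertAll x (reverse ys)))
    ≡⟨ sym (reverse-++ (map (_++ [ y ]) (insertAll x (reverse ys))) [ reverse ys ++ y ∷ x ∷ [] ]) ⟩
  reverse (map (_++ [ y ]) (insertAll x (reverse ys)) ++ [ reverse ys ++ y ∷ x ∷ [] ])
    ≡⟨ cong reverse (sym (insertAll-snoc x (reverse ys) y)) ⟩
  reverse (insertAll x (reverse ys ++ [ y ]))
    ≡⟨ cong (λ z → reverse (insertAll x z)) (sym (unfold-reverse y ys)) ⟩
  reverse (insertAll x (reverse (y ∷ ys))) ∎
  where
  open ≡-Reasoning
  first : reverse (x ∷ y ∷ ys) ≡ reverse ys ++ y ∷ x ∷ []
  first = trans (unfold-reverse x (y ∷ ys)) (trans (cong (_++ [ x ]) (unfold-reverse y ys)) (++-assoc (reverse ys) [ y ] [ x ]))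
  rest : map reverse (map (y ∷_) (insertAll x ys)) ≡ map (_++ [ y ]) (reverse (insertAll x (reverse ys)))
  rest = trans (sym (map-∘ (insertAll x ys)))
           (trans (map-cong (λ a → unfold-reverse y a) (insertAll x ys))
             (trans (map-∘ (insertAll x ys)) (cong (map (_++ [ y ])) (reverse-insertAll x ys))))

concatMap-↭ᶠ : ∀ {A B : Set} (f g : A → List B) xs → (∀ x → f x ↭ g x) → concatMap f xs ↭ concatMap g xs
concatMap-↭ᶠ f g []       h = ↭-refl
concatMap-↭ᶠ f g (x ∷ xs) h = ++⁺ (h x) (concatMap-↭ᶠ f g xs h)

concatMap-↭ : ∀ {A B : Set} (f : A → List B) {xs ys} → xs ↭ ys → concatMap f xs ↭ concatMap f ys
concatMap-↭ f ↭-refl        = ↭-refl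
concatMap-↭ f (prep x p)    = ++⁺ˡ (f x) (concatMap-↭ f p)
concatMap-↭ f (swap x y p)  = ↭-trans (++⁺ˡ (f x) (++⁺ˡ (f y) (concatMap-↭ f p))) (shifts (f x) (f y))
concatMap-↭ f (↭-trans p q) = ↭-trans (concatMap-↭ f p) (concatMap-↭ f q)

perms-reverse : ∀ n → map reverse (perms n) ↭ perms n
perms-reverse zero    = ↭-refl
perms-reverse (suc n) =
  ↭-trans (↭-reflexive (map-concatMap reverse (insertAll (suc n)) (perms n)))
   (↭-trans (concatMap-↭ᶠ _ _ (perms n) (λ τ → ↭-trans (↭-reflexive (reverse-insertAll (suc n) τ)) (↭-reverse _)))
    (↭-trans (↭-reflexive (sym (concatMap-map (insertAll (suc n)) reverse (perms n))))
      (concatMap-↭ (insertAll (suc n)) (perms-reverse n))))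

flipPair : ℕ × Bool → ℕ × Bool
flipPair (i , o) = i , not o

greedyAlt-flip : ∀ c L → greedyAlt c (map flipPair L) ≡ greedyAlt (not c) L
greedyAlt-flip c     [] = refl
greedyAlt-flip false ((i , false) ∷ L) = greedyAlt-flip false L
greedyAlt-flip false ((i , true) ∷ L)  = cong suc (greedyAlt-flip true L)
greedyAlt-flip true  ((i , false) ∷ L) = cong suc (greedyAlt-flip false L)
greedyAlt-flip true  ((i , true) ∷ L)  = greedyAlt-flip true L

sepPairsOn-flip : ∀ σ τ is → (∀ {i} → i ∈ is → separated τ i ≡ separated σ i × isUp τ i ≡ not (isUp σ i)) →
  sepPairsOn τ is ≡ map flipPair (sepPairsOn σ is)
sepPairsOn-flip σ τ []       h = refl
sepPairsOn-flip σ τ (i ∷ is) h with h (here refl)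
... | sep≡ , up≡ with separated σ i
... | true  rewrite sep≡ | up≡ = cong ((i , not (isUp σ i)) ∷_) (sepPairsOn-flip σ τ is (λ p → h (there p)))
... | false rewrite sep≡ = sepPairsOn-flip σ τ is (λ p → h (there p))

sepPairs-reverse : ∀ {σ n'} → IsPermutation σ (suc n') → sepPairs (reverse σ) ≡ map flipPair (sepPairs σ)
sepPairs-reverse {σ} {n'} P = begin
  sepPairs (reverse σ)                             ≡⟨ sepPairs≡ (reverse σ) ⟩
  sepPairsOn (reverse σ) (interval 1 (length (reverse σ) ∸ 1))
    ≡⟨ cong (λ z → sepPairsOn (reverse σ) (interval 1 (z ∸ 1))) (trans (length-reverse σ) len) ⟩
  sepPairsOn (reverse σ) (interval 1 n')            ≡⟨ sepPairsOn-flip σ (reverse σ) (interval 1 n') flips ⟩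
  map flipPair (sepPairsOn σ (interval 1 n'))       ≡⟨ cong (λ z → map flipPair (sepPairsOn σ (interval 1 (z ∸ 1)))) (sym len) ⟩
  map flipPair (sepPairsOn σ (interval 1 (length σ ∸ 1))) ≡⟨ cong (map flipPair) (sym (sepPairs≡ σ)) ⟩
  map flipPair (sepPairs σ)                        ∎
  where
  open ≡-Reasoning
  open IsPermutation P
  flips : ∀ {i} → i ∈ interval 1 n' → separated (reverse σ) i ≡ separated σ i × isUp (reverse σ) i ≡ not (isUp σ i)
  flips {i} q =
    let (1≤i , i<n) = interval-∈⁻ 1 n' q
        a = proj₂ range 1≤i (<⇒≤ i<n)
        b = proj₂ range (s≤s z≤n) i<n
    in trans (separated≡sepAt (reverse σ) i) (trans (sepAt-reverse i σ distinct a b) (sym (separated≡sepAt σ i))) ,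
       trans (isUp≡upAt (reverse σ) i) (trans (upAt-reverse i σ distinct a b) (cong not (sym (isUp≡upAt σ i))))

indicator : Bool → ℕ
indicator true  = 1
indicator false = 0

count-cons : ∀ {A : Set} (p : A → Bool) x xs → count p (x ∷ xs) ≡ indicator (p x) + count p xs
count-cons p x xs with p x
... | true  = refl
... | false = refl

count-cong : ∀ {A : Set} (p q : A → Bool) xs → (∀ {x} → x ∈ xs → p x ≡ q x) → count p xs ≡ count q xs
count-cong p q []       h = refl
count-cong p q (x ∷ xs) h =
  trans (count-cons p x xs)
    (trans (cong₂ _+_ (cong indicator (h (here refl))) (count-cong p q xs (λ r → h (there r))))
           (sym (count-cons q x xs)))

count-map : ∀ {A B : Set} (p : B → Bool) (f : A → B) xs → count p (map f xs) ≡ count (λ x → p (f x)) xs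
count-map p f []       = refl
count-map p f (x ∷ xs) =
  trans (count-cons p (f x) (map f xs))
    (trans (cong (indicator (p (f x)) +_) (count-map p f xs)) (sym (count-cons (λ x → p (f x)) x xs)))

count-↭ : ∀ {A : Set} (p : A → Bool) {xs ys} → xs ↭ ys → count p xs ≡ count p ys
count-↭ p xs↭ys = ↭-length (filter-↭ (λ a → T? (p a)) xs↭ys)

count-none : ∀ {A : Set} (p : A → Bool) xs → (∀ {x} → x ∈ xs → p x ≡ false) → count p xs ≡ 0
count-none p xs h = trans (count-cong p (λ _ → false) xs h) (count-false xs)
  where
  count-false : ∀ {A : Set} (xs : List A) → count (λ _ → false) xs ≡ 0
  count-false []       = refl
  count-false (x ∷ xs) = count-false xs

regroup₃ : ∀ a b c x y z → (a + b + c) + (x + y + z) ≡ (a + x) + (b + y) + (c + z)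
regroup₃ = solve-∀

count-split₃ : ∀ {A : Set} (p q₁ q₂ q₃ : A → Bool) xs →
  (∀ {x} → x ∈ xs → indicator (p x) ≡ indicator (q₁ x) + indicator (q₂ x) + indicator (q₃ x)) →
  count p xs ≡ count q₁ xs + count q₂ xs + count q₃ xs
count-split₃ p q₁ q₂ q₃ []       h = refl
count-split₃ p q₁ q₂ q₃ (x ∷ xs) h = begin
  count p (x ∷ xs)
    ≡⟨ count-cons p x xs ⟩
  indicator (p x) + count p xs
    ≡⟨ cong₂ _+_ (h (here refl)) (count-split₃ p q₁ q₂ q₃ xs (λ r → h (there r))) ⟩
  (indicator (q₁ x) + indicator (q₂ x) + indicator (q₃ x)) + (count q₁ xs + count q₂ xs + count q₃ xs)
    ≡⟨ regroup₃ (indicator (q₁ x)) (indicator (q₂ x)) (indicator (q₃ x)) (count q₁ xs) (count q₂ xs) (count q₃ xs) ⟩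
  (indicator (q₁ x) + count q₁ xs) + (indicator (q₂ x) + count q₂ xs) + (indicator (q₃ x) + count q₃ xs)
    ≡⟨ sym (cong₂ _+_ (cong₂ _+_ (count-cons q₁ x xs) (count-cons q₂ x xs)) (count-cons q₃ x xs)) ⟩
  count q₁ (x ∷ xs) + count q₂ (x ∷ xs) + count q₃ (x ∷ xs) ∎
  where open ≡-Reasoning

trichotomy : ∀ L x → indicator x ≡
  indicator (null L ∧ x) + indicator (startsWith true L ∧ x) + indicator (startsWith false L ∧ x)
trichotomy []               x     = sym (trans (+-identityʳ _) (+-identityʳ _))
trichotomy ((i , true) ∷ L)  true  = refl
trichotomy ((i , true) ∷ L)  false = refl
trichotomy ((i , false) ∷ L) true  = refl
trichotomy ((i , false) ∷ L) false = refl

no-pairs-tier : ∀ L t → (null L ∧ (greedyAlt false L ≡ᵇ t)) ≡ (null L ∧ (0 ≡ᵇ t))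
no-pairs-tier []      t = refl
no-pairs-tier (_ ∷ L) t = refl

-- Starting down, the greedy scan takes the first pair, so the tier is positive.
down-start-tier : ∀ L → (startsWith false L ∧ (greedyAlt false L ≡ᵇ 0)) ≡ false
down-start-tier []                = refl
down-start-tier ((i , false) ∷ L) = refl
down-start-tier ((i , true) ∷ L)  = refl

flip-start-tier : ∀ L t →
  (startsWith false (map flipPair L) ∧ (greedyAlt true L ≡ᵇ suc t)) ≡ (startsWith true L ∧ (greedyAlt false L ≡ᵇ t))
flip-start-tier []                t = refl
flip-start-tier ((i , false) ∷ L) t = refl
flip-start-tier ((i , true) ∷ L)  t = refl

hasTier-just : ∀ σ x t → revTier σ ≡ just x → hasTier t σ ≡ (x ≡ᵇ t)
hasTier-just σ x t e with revTier σ | e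
... | _ | refl = refl

module Coefficients (n' : ℕ) where

  n : ℕ
  n = suc n'

  tier : ∀ {σ} → σ ∈ perms n → ∀ t → hasTier t σ ≡ (greedyAlt false (sepPairs σ) ≡ᵇ t)
  tier {σ} p t = let open IsPermutation (perms-isPermutation n p) in
    hasTier-just σ _ t (revTier-formula σ n' distinct range len)

  tier-reverse : ∀ {σ} → σ ∈ perms n → ∀ t → hasTier t (reverse σ) ≡ (greedyAlt true (sepPairs σ) ≡ᵇ t)
  tier-reverse {σ} p t = let open IsPermutation (reverse-isPermutation (perms-isPermutation n p)) in
    trans (hasTier-just (reverse σ) _ t (revTier-formula (reverse σ) n' distinct range len))
          (cong (_≡ᵇ t) (trans (cong (greedyAlt false) (sepPairs-reverse (perms-isPermutation n p)))
                               (greedyAlt-flip false (sepPairs σ))))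

  coeffF-split : ∀ t → coeffF n t ≡ count (λ σ → inN σ ∧ hasTier t σ) (perms n) + coeffMU n t + coeffMD n t
  coeffF-split t = count-split₃ (hasTier t) _ _ _ (perms n) (λ {σ} p →
    trans (trichotomy (sepPairs σ) (hasTier t σ))
          (cong₂ _+_ (cong (λ z → indicator (inN σ ∧ hasTier t σ) + indicator (z ∧ hasTier t σ)) (sym (oriented-head true σ)))
                     (cong (λ z → indicator (z ∧ hasTier t σ)) (sym (oriented-head false σ)))))

  coeffFN-count : ∀ t → count (λ σ → inN σ ∧ hasTier t σ) (perms n) ≡ coeffFN n t
  coeffFN-count zero = count-cong _ _ (perms n) (λ {σ} p →
    trans (cong (inN σ ∧_) (tier p 0)) (trans (no-pairs-tier (sepPairs σ) 0) (∧-identityʳ _)))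
  coeffFN-count (suc t) = count-none _ (perms n) (λ {σ} p →
    trans (cong (inN σ ∧_) (tier p (suc t))) (trans (no-pairs-tier (sepPairs σ) (suc t)) (∧-zeroʳ _)))

  -- M^D has no constant term ...
  coeffMD-zero : coeffMD n 0 ≡ 0
  coeffMD-zero = count-none _ (perms n) (λ {σ} p →
    trans (cong₂ _∧_ (oriented-head false σ) (tier p 0)) (down-start-tier (sepPairs σ)))

  -- ... and reversal matches down-oriented tier t+1 with up-oriented tier t: M^D = y M^U.
  coeffMD-shift : ∀ t → coeffMD n (suc t) ≡ coeffMU n t
  coeffMD-shift t = begin
    count isMD (perms n)                      ≡⟨ count-↭ isMD (↭-sym (perms-reverse n)) ⟩
    count isMD (map reverse (perms n))        ≡⟨ count-map isMD reverse (perms n) ⟩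
    count (λ σ → isMD (reverse σ)) (perms n)  ≡⟨ count-cong _ _ (perms n) reversed ⟩
    coeffMU n t                               ∎
    where
    open ≡-Reasoning
    isMD : List ℕ → Bool
    isMD σ = oriented false σ ∧ hasTier (suc t) σ
    reversed : ∀ {σ} → σ ∈ perms n → isMD (reverse σ) ≡ (oriented true σ ∧ hasTier t σ)
    reversed {σ} p =
      trans (cong₂ _∧_ (trans (oriented-head false (reverse σ)) (cong (startsWith false) (sepPairs-reverse (perms-isPermutation n p))))
                       (tier-reverse p (suc t)))
            (trans (flip-start-tier (sepPairs σ) t) (sym (cong₂ _∧_ (oriented-head true σ) (tier p t))))

mainTheorem15 : (n t : ℕ) → 1 ≤ n →
    (coeffF n t ≡ coeffFN n t + coeffMU n t + coeffYMU n t)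
    × (coeffF n t ≡ coeffFN n t + coeffMD n t + coeffMD n (Data.Nat.suc t))
    × (coeffMD n 0 ≡ 0)
mainTheorem15 (suc n') t (s≤s z≤n) = viaMU t , viaMD , coeffMD-zero
  where
  open Coefficients n'
  open ≡-Reasoning
  split : ∀ t → coeffF n t ≡ coeffFN n t + coeffMU n t + coeffMD n t
  split t = trans (coeffF-split t) (cong (λ z → z + coeffMU n t + coeffMD n t) (coeffFN-count t))
  viaMU : ∀ t → coeffF n t ≡ coeffFN n t + coeffMU n t + coeffYMU n t
  viaMU zero    = trans (split 0) (cong (coeffFN n 0 + coeffMU n 0 +_) coeffMD-zero)
  viaMU (suc t) = trans (split (suc t)) (cong (coeffFN n (suc t) + coeffMU n (suc t) +_) (coeffMD-shift t))
  viaMD : coeffF n t ≡ coeffFN n t + coeffMD n t + coeffMD n (suc t)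
  viaMD = begin
    coeffF n t                                    ≡⟨ split t ⟩
    coeffFN n t + coeffMU n t + coeffMD n t       ≡⟨ cong (λ z → coeffFN n t + z + coeffMD n t) (sym (coeffMD-shift t)) ⟩
    coeffFN n t + coeffMD n (suc t) + coeffMD n t ≡⟨ +-assoc-swap (coeffFN n t) (coeffMD n (suc t)) (coeffMD n t) ⟩
    coeffFN n t + coeffMD n t + coeffMD n (suc t) ∎
    where
    +-assoc-swap : ∀ a b c → a + b + c ≡ a + c + b
    +-assoc-swap = solve-∀
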